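{- Let $\ell, n_1,\dots,n_\ell$ be positive integers, $n=n_1+\cdots+n_\ell$, let $K_1,\dots,K_\ell$ be finite fields with a common finite extension field $\mathbb{F}$, and let $\mathcal{C}\subseteq \mathbb{F}^n$ be a $k$-dimensional $\mathbb{F}$-linear sum-rank metric code with $k\times n$ generator matrix $\mathbf{G}$. Then $\mathcal{C}$ is MSRD (i.e. $d_{SR,1}(\mathcal{C})=n-k+1$) if and only if $\mathbf{G}\mathbf{A}$ is invertible for every $n\times k$ matrix $\mathbf{A}$ of rank $k$ of the block-diagonal form $\mathbf{A}=\mathrm{diag}(\mathbf{A}_1,\dots,\mathbf{A}_\ell)$, where each $\mathbf{A}_i$ is an $n_i\times k_i$ matrix with entries in $K_i$, $k_i\le n_i$, and $\sum_{i=1}^\ell k_i=k$.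
   Context: Setting: $[\mathbb{F}:K_i]=m_i$. Vectors $\mathbf{c}\in\mathbb{F}^n$ are written $\mathbf{c}=(\mathbf{c}^{(1)},\dots,\mathbf{c}^{(\ell)})$ with $\mathbf{c}^{(i)}\in\mathbb{F}^{n_i}$. Fix an ordered basis $\Gamma_i$ of $\mathbb{F}$ over $K_i$; $\Gamma_i(\mathbf{c}^{(i)})$ is the $m_i\times n_i$ matrix over $K_i$ whose $j$-th column is the coordinate vector of the $j$-th entry of $\mathbf{c}^{(i)}$ in the basis $\Gamma_i$. The sum-rank support of $\mathbf{c}$ is $\mathrm{supp}(\mathbf{c})=(\mathcal{L}_1,\dots,\mathcal{L}_\ell)$ where $\mathcal{L}_i$ is the $K_i$-row space of $\Gamma_i(\mathbf{c}^{(i)})$. $\mathcal{P}(\mathbf{K}^{\mathbf{n}})$ is the set of tuples $\mathcal{L}=(\mathcal{L}_1,\dots,\mathcal{L}_\ell)$ with $\mathcal{L}_i$ a $K_i$-subspace of $K_i^{n_i}$, ordered by componentwise inclusion, and $\mathrm{Rk}(\mathcal{L})=\sum_i\dim_{K_i}\mathcal{L}_i$. For $\mathcal{L}\in\mathcal{P}(\mathbf{K}^{\mathbf{n}})$, $\mathcal{V}_{\mathcal{L}}=\{\mathbf{c}\in\mathbb{F}^n:\mathrm{supp}(\mathbf{c})\subseteq\mathcal{L}\}$ (componentwise inclusion). The $i$-th generalized sum-rank weight of a $k$-dimensional code $\mathcal{C}$ is $d_{SR,i}(\mathcal{C})=\min\{\mathrm{Rk}(\mathcal{L}):\mathcal{L}\in\mathcal{P}(\mathbf{K}^{\mathbf{n}}),\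 \dim_{\mathbb{F}}(\mathcal{C}\cap\mathcal{V}_{\mathcal{L}})\ge i\}$ for $1\le i\le k$; $d_{SR,1}(\mathcal{C})$ is the minimum sum-rank distance. $\mathcal{C}$ is called MSRD if $d_{SR,1}(\mathcal{C})=n-k+1$. -}

module Defs where

open import Level using (0ℓ)
open import Algebra.Bundles using (CommutativeRing)
open import Data.Nat using (ℕ; zero; suc) renaming (_+_ to _+ℕ_; _≤_ to _≤ℕ_; _∸_ to _∸ℕ_)
open import Data.Fin using (Fin; zero; suc)
open import Data.Fin.Properties using () renaming (_≟_ to _≟F_)
open import Data.Product using (Σ; _×_; _,_; ∃; ∃-syntax)
open import Data.Product.Properties using (≡-dec)
open import Data.List using (List)
open import Data.List.Relation.Unary.Any using (Any)
open import Data.Unit using (⊤)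
open import Relation.Nullary using (¬_; Dec; yes; no)
open import Relation.Binary.PropositionalEquality using (_≡_; refl)

sumℕ : ∀ {ℓ} → (Fin ℓ → ℕ) → ℕ
sumℕ {zero} f = 0
sumℕ {suc ℓ} f = f zero +ℕ sumℕ (λ i → f (suc i))

-- Block index set: the coordinates of F^n, n = n_1 + ... + n_ℓ, grouped
-- into ℓ blocks; (i , t) is the t-th coordinate of the i-th block.
Idx : ∀ {ℓ} → (Fin ℓ → ℕ) → Set
Idx {ℓ} ns = Σ (Fin ℓ) (λ i → Fin (ns i))

record FiniteField : Set₁ where
  field
    commRing : CommutativeRing 0ℓ 0ℓ
  open CommutativeRing commRing public
    using (Carrier; _≈_; _+_; _*_; -_; 0#; 1#)
  field
    0≉1           : ¬ (0# ≈ 1#)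
    inverse       : ∀ x → ¬ (x ≈ 0#) → ∃[ y ] (x * y ≈ 1#)
    _≈?_          : ∀ x y → Dec (x ≈ y)
    enum          : List Carrier
    enum-complete : ∀ x → Any (x ≈_) enum

module _ (F : FiniteField) where
  open FiniteField F

  sumFin : ∀ {m} → (Fin m → Carrier) → Carrier
  sumFin {zero} f = 0#
  sumFin {suc m} f = f zero + sumFin (λ j → f (suc j))

  sumIdx : ∀ {ℓ} (ns : Fin ℓ → ℕ) → (Idx ns → Carrier) → Carrier
  sumIdx ns f = sumFin (λ i → sumFin (λ t → f (i , t)))

  record Subfield : Set₁ where
    field
      K      : Carrier → Set
      K-resp : ∀ {x y} → x ≈ y → K x → K y
      K-0    : K 0#
      K-1    : K 1#
      K-+    : ∀ {x y} → K x → K y → K (x + y)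
      K-neg  : ∀ {x} → K x → K (- x)
      K-*    : ∀ {x y} → K x → K y → K (x * y)
      K-inv  : ∀ {x y} → K x → x * y ≈ 1# → K y

  LinIndep : (Carrier → Set) → ∀ {d} {X : Set} → (Fin d → X → Carrier) → Set
  LinIndep P {d} {X} v =
    (a : Fin d → Carrier) → (∀ r → P (a r)) →
    (∀ x → sumFin (λ r → a r * v r x) ≈ 0#) → ∀ r → a r ≈ 0#

  RowSpace : (Carrier → Set) → ∀ {d n} → (Fin d → Fin n → Carrier) → (Fin n → Carrier) → Set
  RowSpace P {d} {n} M v =
    Σ (Fin d → Carrier) λ a → ((∀ (j : Fin d) → P (a j)) × (∀ t → v t ≈ sumFin (λ j → a j * M j t)))

  record OrderedBasis (K : Subfield) : Set where
    open Subfield K using () renaming (K to inK)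
    field
      m      : ℕ
      γ      : Fin m → Carrier
      coord  : Carrier → Fin m → Carrier
      coord-K : ∀ x j → inK (coord x j)
      expand : ∀ x → x ≈ sumFin (λ j → coord x j * γ j)
      indep  : (a : Fin m → Carrier) → (∀ j → inK (a j)) →
               sumFin (λ j → a j * γ j) ≈ 0# → ∀ j → a j ≈ 0#

  ΓMat : ∀ {K} → (B : OrderedBasis K) → ∀ {n} → (Fin n → Carrier) →
         Fin (OrderedBasis.m B) → Fin n → Carrier
  ΓMat B c j t = OrderedBasis.coord B (c t) j

  record Subspace (K : Subfield) (n : ℕ) : Set where
    open Subfield K using () renaming (K to inK)
    field
      dim     : ℕ
      basis   : Fin dim → Fin n → Carrier
      basis-K : ∀ r t → inK (basis r t)
      basis-indep : LinIndep inK basis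

  _∈ˢ_ : ∀ {K n} → (Fin n → Carrier) → Subspace K n → Set
  _∈ˢ_ {K} v L = RowSpace (Subfield.K K) (Subspace.basis L) v

  module SumRank {ℓ : ℕ} (ns : Fin ℓ → ℕ) (Ks : Fin ℓ → Subfield)
                 (Γ : (i : Fin ℓ) → OrderedBasis (Ks i)) where

    N : ℕ
    N = sumℕ ns

    Vec' : Set
    Vec' = Idx ns → Carrier

    -- Elements of P(K^n): tuples of subspaces L_i ⊆ K_i^{n_i}.
    SubTuple : Set
    SubTuple = (i : Fin ℓ) → Subspace (Ks i) (ns i)

    Rk : SubTuple → ℕ
    Rk L = sumℕ (λ i → Subspace.dim (L i))

    -- supp(c) ⊆ L : each row space of Γ_i(c^(i)) is contained in L_i.
    SuppIn : Vec' → SubTuple → Set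
    SuppIn c L = ∀ i (v : Fin (ns i) → Carrier) →
      RowSpace (Subfield.K (Ks i)) (ΓMat (Γ i) (λ t → c (i , t))) v → v ∈ˢ L i

    InCode : ∀ {k} → (Fin k → Idx ns → Carrier) → Vec' → Set
    InCode {k} G c = Σ (Fin k → Carrier) λ x → (∀ p → c p ≈ sumFin (λ (r : Fin k) → x r * G r p))

    -- dim_F (C ∩ V_L) ≥ j : C ∩ V_L contains j F-linearly independent vectors.
    DimAtLeast : ∀ {k} → (Fin k → Idx ns → Carrier) → ℕ → SubTuple → Set
    DimAtLeast G j L =
      Σ (Fin j → Vec') λ w → ((∀ (r : Fin j) → InCode G (w r) × SuppIn (w r) L) × LinIndep (λ _ → ⊤) w)

    -- d_{SR,j}(C) = d  (d is the minimum of Rk(L) over L with dim(C ∩ V_L) ≥ j).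
    GenSRWeightIs : ∀ {k} → (Fin k → Idx ns → Carrier) → ℕ → ℕ → Set
    GenSRWeightIs G j d =
      (Σ SubTuple λ L → (Rk L ≡ d × DimAtLeast G j L)) × (∀ L → DimAtLeast G j L → d ≤ℕ Rk L)

    IsMSRD : ∀ {k} → (Fin k → Idx ns → Carrier) → Set
    IsMSRD {k} G = GenSRWeightIs G 1 (N ∸ℕ k +ℕ 1)

  blockDiag : ∀ {ℓ} {ns ks : Fin ℓ → ℕ} →
              ((i : Fin ℓ) → Fin (ns i) → Fin (ks i) → Carrier) →
              Idx ns → Idx ks → Carrier
  blockDiag A (i' , t) (i , s) with i' ≟F i
  ... | yes refl = A i t s
  ... | no _ = 0#

  FullColumnRank : ∀ {ℓ} {ns ks : Fin ℓ → ℕ} → (Idx ns → Idx ks → Carrier) → Set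
  FullColumnRank {ns = ns} {ks} M =
    (a : Idx ks → Carrier) → (∀ p → sumIdx ks (λ q → M p q * a q) ≈ 0#) → ∀ q → a q ≈ 0#

  mulGM : ∀ {k ℓ} {ns ks : Fin ℓ → ℕ} → (Fin k → Idx ns → Carrier) →
          (Idx ns → Idx ks → Carrier) → Fin k → Idx ks → Carrier
  mulGM {ns = ns} G M r q = sumIdx ns (λ p → G r p * M p q)

  δ : ∀ {X : Set} → (∀ (x y : X) → Dec (x ≡ y)) → X → X → Carrier
  δ dec x y with dec x y
  ... | yes _ = 1#
  ... | no _ = 0#

  Invertible : ∀ {k ℓ} {ks : Fin ℓ → ℕ} → (Fin k → Idx ks → Carrier) → Set
  Invertible {k} {ks = ks} M =
    Σ (Idx ks → Fin k → Carrier) λ B → ((∀ r r' → sumIdx ks (λ q → M r q * B q r') ≈ δ _≟F_ r r') ×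
            (∀ q q' → sumFin (λ (r : Fin k) → B q r * M r q') ≈ δ (≡-dec _≟F_ _≟F_) q q'))

{-# OPTIONS --safe #-}
module Submission where

-- For c = x G and a block-diagonal A whose blocks have entries in the Kᵢ, c A = 0 exactly when every
-- row of every Γᵢ(c⁽ⁱ⁾) is orthogonal to the columns of Aᵢ, i.e. when supp(c) lies in the tuple of
-- Kᵢ-orthogonal complements of the column spaces, of rank n - k. So a nonzero x in the left kernel of
-- a singular G A gives a nonzero codeword of weight ≤ n - k; conversely a nonzero codeword supported
-- on a tuple of rank ≤ n - k yields such an A with x (G A) = 0. The weight n - k + 1 is attained by a
-- row of (G A)⁻¹ G for an A selecting k coordinates. The orthogonal complements and their dimensions
-- come from Gaussian elimination over each Kᵢ.

open import Level using (0ℓ)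
open import Algebra.Bundles using (CommutativeRing; RawRing)
open import Algebra.Solver.Ring.AlmostCommutativeRing
  using (fromCommutativeRing; _-Raw-AlmostCommutative⟶_)
import Algebra.Properties.Semiring.Mult as SemiringMult
import Algebra.Properties.Monoid.Mult as MonoidMult
import Algebra.Properties.Ring as RingProperties
import Algebra.Properties.AbelianGroup as AbelianGroupProperties
import Algebra.Properties.Semiring.Sum as SemiringSum
import Algebra.Solver.Ring
open import Data.Empty using (⊥-elim)
open import Data.Fin as Fin using (Fin; zero; suc; punchIn; punchOut)
import Data.Fin.Properties as Fin
open import Data.Maybe using (Maybe; nothing; just)
open import Data.Nat as ℕ using (ℕ; zero; suc; _≤_; _<_; z≤n; s≤s)
import Data.Nat.Properties as ℕ
import Algebra.Properties.CommutativeSemigroup ℕ.+-commutativeSemigroup as ℕ+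
open import Data.Product using (Σ; _×_; _,_; proj₁; proj₂; ∃-syntax)
open import Data.Product.Properties using (≡-dec)
open import Data.Sum using (_⊎_; inj₁; inj₂)
open import Data.Unit using (⊤; tt)
open import Data.Vec.Functional using (_∷_; removeAt; insertAt; updateAt)
import Data.Vec.Functional.Properties as Vector
open import Function using (_∘_)
open import Function.Bundles using (_⇔_; mk⇔)
open import Relation.Nullary using (¬_; yes; no)
open import Relation.Binary.Definitions using (DecidableEquality)
open import Relation.Binary.PropositionalEquality as ≡ using (_≡_; _≢_)
open import Defs

-- The solvers of the library need coefficients with decidable equality,
-- which an abstract commutative ring lacks; formal differences a - b of
-- natural numbers serve instead.
module CommutativeRingSolver (R : CommutativeRing 0ℓ 0ℓ) where
  open CommutativeRing R
  open import Relation.Binary.Reasoning.Setoid setoid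
  open SemiringMult semiring using (×1-homo-*) renaming (_×_ to _×′_)
  open MonoidMult +-monoid using (×-homo-+; ×-congˡ)
  open RingProperties ring using (-‿distribˡ-*; -‿distribʳ-*; -‿involutive; -0#≈0#)
  open AbelianGroupProperties +-abelianGroup using (⁻¹-∙-comm)

  Differences : RawRing 0ℓ 0ℓ
  Differences = record
    { Carrier = ℕ × ℕ ; _≈_ = _≡_
    ; _+_ = λ { (a , b) (c , d) → a ℕ.+ c , b ℕ.+ d }
    ; _*_ = λ { (a , b) (c , d) → a ℕ.* c ℕ.+ b ℕ.* d , a ℕ.* d ℕ.+ b ℕ.* c }
    ; -_ = λ { (a , b) → b , a }
    ; 0# = 0 , 0 ; 1# = 1 , 0 }

  embed : ℕ × ℕ → Carrier
  embed (a , b) = a ×′ 1# - b ×′ 1#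

  -‿distrib-+ : ∀ x y → - (x + y) ≈ - x + - y
  -‿distrib-+ x y = sym (⁻¹-∙-comm x y)

  sub-+-sub : ∀ x y z w → (x - y) + (z - w) ≈ (x + z) - (y + w)
  sub-+-sub x y z w = begin
    (x - y) + (z - w)     ≈⟨ +-assoc x (- y) (z - w) ⟩
    x + (- y + (z - w))   ≈⟨ +-congˡ (sym (+-assoc (- y) z (- w))) ⟩
    x + ((- y + z) - w)   ≈⟨ +-congˡ (+-congʳ (+-comm (- y) z)) ⟩
    x + ((z - y) - w)     ≈⟨ +-congˡ (+-assoc z (- y) (- w)) ⟩
    x + (z + (- y - w))   ≈⟨ sym (+-assoc x z (- y - w)) ⟩
    (x + z) + (- y - w)   ≈⟨ +-congˡ (sym (-‿distrib-+ y w)) ⟩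
    (x + z) - (y + w)     ∎

  sub-*-sub : ∀ x y z w → (x - y) * (z - w) ≈ (x * z + y * w) - (x * w + y * z)
  sub-*-sub x y z w = begin
    (x - y) * (z - w)                           ≈⟨ distribʳ (z - w) x (- y) ⟩
    x * (z - w) + - y * (z - w)                 ≈⟨ +-cong (distribˡ x z (- w)) (distribˡ (- y) z (- w)) ⟩
    (x * z + x * - w) + (- y * z + - y * - w)   ≈⟨ +-cong (+-congˡ (sym (-‿distribʳ-* x w))) (+-cong (sym (-‿distribˡ-* y z)) neg-neg) ⟩
    (x * z - x * w) + (- (y * z) + y * w)       ≈⟨ +-congˡ (+-comm (- (y * z)) (y * w)) ⟩
    (x * z - x * w) + (y * w - y * z)           ≈⟨ sub-+-sub (x * z) (x * w) (y * w) (y * z) ⟩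
    (x * z + y * w) - (x * w + y * z)           ∎
    where
    neg-neg : - y * - w ≈ y * w
    neg-neg = trans (sym (-‿distribˡ-* y (- w)))
                    (trans (-‿cong (sym (-‿distribʳ-* y w))) (-‿involutive (y * w)))

  homomorphism : Differences -Raw-AlmostCommutative⟶ fromCommutativeRing R
  homomorphism = record
    { ⟦_⟧ = embed
    ; +-homo = λ { (a , b) (c , d) →
        trans (+-cong (×-homo-+ 1# a c) (-‿cong (×-homo-+ 1# b d))) (sym (sub-+-sub _ _ _ _)) }
    ; *-homo = λ { (a , b) (c , d) →
        trans (+-cong (×·×-homo a c b d) (-‿cong (×·×-homo a d b c))) (sym (sub-*-sub _ _ _ _)) }
    ; -‿homo = λ { (a , b) →
        trans (+-comm (b ×′ 1#) (- (a ×′ 1#)))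
              (trans (+-congˡ (sym (-‿involutive (b ×′ 1#)))) (sym (-‿distrib-+ (a ×′ 1#) (- (b ×′ 1#))))) }
    ; 0-homo = -‿inverseʳ 0#
    ; 1-homo = trans (+-cong (+-identityʳ 1#) -0#≈0#) (+-identityʳ 1#)
    }
    where
    ×·×-homo : ∀ a c b d → (a ℕ.* c ℕ.+ b ℕ.* d) ×′ 1# ≈ (a ×′ 1#) * (c ×′ 1#) + (b ×′ 1#) * (d ×′ 1#)
    ×·×-homo a c b d = trans (×-homo-+ 1# (a ℕ.* c) (b ℕ.* d)) (+-cong (×1-homo-* a c) (×1-homo-* b d))

  embed-cancel : ∀ a b c d → a ℕ.+ d ≡ c ℕ.+ b → embed (a , b) ≈ embed (c , d)
  embed-cancel a b c d eq = begin
    A - B                ≈⟨ sym (+-identityʳ _) ⟩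
    (A - B) + 0#         ≈⟨ +-congˡ (sym (-‿inverseʳ D)) ⟩
    (A - B) + (D - D)    ≈⟨ sub-+-sub A B D D ⟩
    (A + D) - (B + D)    ≈⟨ +-congʳ (trans (sym (×-homo-+ 1# a d)) (trans (×-congˡ eq) (×-homo-+ 1# c b))) ⟩
    (C + B) - (B + D)    ≈⟨ +-congˡ (-‿cong (+-comm B D)) ⟩
    (C + B) - (D + B)    ≈⟨ sym (sub-+-sub C D B B) ⟩
    (C - D) + (B - B)    ≈⟨ +-congˡ (-‿inverseʳ B) ⟩
    (C - D) + 0#         ≈⟨ +-identityʳ _ ⟩
    C - D                ∎
    where A = a ×′ 1#; B = b ×′ 1#; C = c ×′ 1#; D = d ×′ 1#

  embed-≟ : ∀ x y → Maybe (embed x ≈ embed y)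
  embed-≟ (a , b) (c , d) with a ℕ.+ d ℕ.≟ c ℕ.+ b
  ... | yes eq = just (embed-cancel a b c d eq)
  ... | no _ = nothing

  open Algebra.Solver.Ring Differences (fromCommutativeRing R) homomorphism embed-≟ public

pivot-or-punchIn : ∀ {n} (t u : Fin (suc n)) → t ≡ u ⊎ ∃[ u′ ] punchIn t u′ ≡ u
pivot-or-punchIn t u with t Fin.≟ u
... | yes t≡u = inj₁ t≡u
... | no t≢u = inj₂ (punchOut t≢u , Fin.punchIn-punchOut t≢u)

sumℕ-zero : ∀ ℓ → sumℕ {ℓ} (λ _ → 0) ≡ 0
sumℕ-zero zero = ≡.refl
sumℕ-zero (suc ℓ) = sumℕ-zero ℓ

sumℕ-distrib-+ : ∀ {ℓ} (f g : Fin ℓ → ℕ) → sumℕ (λ i → f i ℕ.+ g i) ≡ sumℕ f ℕ.+ sumℕ g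
sumℕ-distrib-+ {zero} f g = ≡.refl
sumℕ-distrib-+ {suc ℓ} f g = ≡.trans (≡.cong (f zero ℕ.+ g zero ℕ.+_) (sumℕ-distrib-+ (f ∘ suc) (g ∘ suc)))
  (ℕ+.interchange (f zero) (g zero) (sumℕ (f ∘ suc)) (sumℕ (g ∘ suc)))

sumℕ-mono-≤ : ∀ {ℓ} {f g : Fin ℓ → ℕ} → (∀ i → f i ≤ g i) → sumℕ f ≤ sumℕ g
sumℕ-mono-≤ {zero} _ = z≤n
sumℕ-mono-≤ {suc ℓ} f≤g = ℕ.+-mono-≤ (f≤g zero) (sumℕ-mono-≤ (f≤g ∘ suc))

sumℕ-updateAt-suc : ∀ {ℓ} (f : Fin ℓ → ℕ) i → sumℕ (updateAt f i suc) ≡ suc (sumℕ f)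
sumℕ-updateAt-suc f zero = ≡.refl
sumℕ-updateAt-suc f (suc i) = ≡.trans (≡.cong (f zero ℕ.+_) (sumℕ-updateAt-suc (f ∘ suc) i)) (ℕ.+-suc _ _)

sumℕ<⇒∃< : ∀ {ℓ} (f g : Fin ℓ → ℕ) → sumℕ f < sumℕ g → ∃[ i ] f i < g i
sumℕ<⇒∃< {suc ℓ} f g Σf<Σg with f zero ℕ.<? g zero
... | yes f₀<g₀ = zero , f₀<g₀
... | no f₀≮g₀ =
  let (i , fᵢ<gᵢ) = sumℕ<⇒∃< (f ∘ suc) (g ∘ suc)
                      (ℕ.+-cancelˡ-< (g zero) _ _ (ℕ.≤-<-trans (ℕ.+-monoˡ-≤ _ (ℕ.≮⇒≥ f₀≮g₀)) Σf<Σg))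
  in suc i , fᵢ<gᵢ

≤sumℕ⇒decomposition : ∀ {ℓ} (u : Fin ℓ → ℕ) k → k ≤ sumℕ u →
                      ∃[ ks ] (∀ i → ks i ≤ u i) × sumℕ ks ≡ k
≤sumℕ⇒decomposition {zero} u zero _ = (λ ()) , (λ ()) , ≡.refl
≤sumℕ⇒decomposition {suc ℓ} u k k≤Σu with k ℕ.≤? u zero
... | yes k≤u₀ = k ∷ (λ _ → 0) , (λ { zero → k≤u₀ ; (suc i) → z≤n }) ,
                 ≡.trans (≡.cong (k ℕ.+_) (sumℕ-zero ℓ)) (ℕ.+-identityʳ k)
... | no k≰u₀ =
  let (ks , ks≤u , Σks≡k∸u₀) = ≤sumℕ⇒decomposition (u ∘ suc) (k ℕ.∸ u zero) (ℕ.m≤n+o⇒m∸n≤o k (u zero) k≤Σu)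
  in u zero ∷ ks , (λ { zero → ℕ.≤-refl ; (suc i) → ks≤u i }) ,
     ≡.trans (≡.cong (u zero ℕ.+_) Σks≡k∸u₀) (ℕ.m+[n∸m]≡n (ℕ.<⇒≤ (ℕ.≰⇒> k≰u₀)))

m+n≤o⇒o∸n+1≰m : ∀ {m n o} → m ℕ.+ n ≤ o → ¬ (o ℕ.∸ n ℕ.+ 1 ≤ m)
m+n≤o⇒o∸n+1≰m {m} {n} {o} m+n≤o o∸n+1≤m =
  ℕ.1+n≰n (ℕ.≤-trans (ℕ.≤-reflexive (ℕ.+-comm 1 (o ℕ.∸ n))) (ℕ.≤-trans o∸n+1≤m (ℕ.m+n≤o⇒m≤o∸n m m+n≤o)))

o≤m+n⇒k≤m : ∀ {m n o k} → k ≤ o → o ≤ m ℕ.+ n → ¬ (o ℕ.∸ k ℕ.+ 1 ≤ n) → k ≤ m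
o≤m+n⇒k≤m {m} {n} {o} {k} k≤o o≤m+n o∸k+1≰n = ℕ.+-cancelʳ-≤ (o ℕ.∸ k) k m (begin
  k ℕ.+ (o ℕ.∸ k)   ≡⟨ ℕ.m+[n∸m]≡n k≤o ⟩
  o                 ≤⟨ o≤m+n ⟩
  m ℕ.+ n           ≤⟨ ℕ.+-monoʳ-≤ m n≤o∸k ⟩
  m ℕ.+ (o ℕ.∸ k)   ∎)
  where
  open ℕ.≤-Reasoning
  n≤o∸k : n ≤ o ℕ.∸ k
  n≤o∸k = ℕ.≤-pred (ℕ.≤-trans (ℕ.≰⇒> o∸k+1≰n) (ℕ.≤-reflexive (ℕ.+-comm (o ℕ.∸ k) 1)))

m+[k∸1]≡o⇒m≡o∸k+1 : ∀ {m k o} → 1 ≤ k → k ≤ o → m ℕ.+ (k ℕ.∸ 1) ≡ o → m ≡ o ℕ.∸ k ℕ.+ 1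
m+[k∸1]≡o⇒m≡o∸k+1 {m} {suc k} {o} _ 1+k≤o m+k≡o = begin
  m                   ≡⟨ ≡.sym (ℕ.m+n∸n≡m m k) ⟩
  m ℕ.+ k ℕ.∸ k       ≡⟨ ≡.cong (ℕ._∸ k) m+k≡o ⟩
  o ℕ.∸ k             ≡⟨ ℕ.+-∸-assoc 1 1+k≤o ⟩
  1 ℕ.+ (o ℕ.∸ suc k) ≡⟨ ℕ.+-comm 1 (o ℕ.∸ suc k) ⟩
  o ℕ.∸ suc k ℕ.+ 1   ∎
  where open ≡.≡-Reasoning

fromIdx : ∀ {ℓ} (ns : Fin ℓ → ℕ) → Idx ns → Fin (sumℕ ns)
fromIdx {suc ℓ} ns (zero , t) = t Fin.↑ˡ sumℕ (ns ∘ suc)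
fromIdx {suc ℓ} ns (suc i , t) = ns zero Fin.↑ʳ fromIdx (ns ∘ suc) (i , t)

toIdx : ∀ {ℓ} (ns : Fin ℓ → ℕ) → Fin (sumℕ ns) → Idx ns
toIdx {suc ℓ} ns j with Fin.splitAt (ns zero) j
... | inj₁ t = zero , t
... | inj₂ j′ = let (i , t) = toIdx (ns ∘ suc) j′ in suc i , t

toIdx-fromIdx : ∀ {ℓ} (ns : Fin ℓ → ℕ) p → toIdx ns (fromIdx ns p) ≡ p
toIdx-fromIdx {suc ℓ} ns (zero , t)
  rewrite Fin.splitAt-↑ˡ (ns zero) t (sumℕ (ns ∘ suc)) = ≡.refl
toIdx-fromIdx {suc ℓ} ns (suc i , t)
  rewrite Fin.splitAt-↑ʳ (ns zero) (sumℕ (ns ∘ suc)) (fromIdx (ns ∘ suc) (i , t))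
        | toIdx-fromIdx (ns ∘ suc) (i , t) = ≡.refl

module FiniteSums (F : FiniteField) where
  open FiniteField F using (commRing)
  open CommutativeRing commRing hiding (zero)
  open import Relation.Binary.Reasoning.Setoid setoid
  open SemiringSum semiring using (sum; sum-cong-≋; sum-remove; *-distribˡ-sum; *-distribʳ-sum)
    renaming (∑-comm to sum-comm; ∑-distrib-+ to sum-distrib-+)
  open RingProperties ring using (-0#≈0#)
  open AbelianGroupProperties +-abelianGroup using (⁻¹-∙-comm)
  open import Algebra.Properties.CommutativeSemigroup *-commutativeSemigroup using (x∙yz≈y∙xz)

  ∑ : ∀ {m} → (Fin m → Carrier) → Carrier
  ∑ = sumFin F

  ∑ᴵ : ∀ {ℓ} (ns : Fin ℓ → ℕ) → (Idx ns → Carrier) → Carrier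
  ∑ᴵ = sumIdx F

  infix 8 _·_
  _·_ : ∀ {n} → (Fin n → Carrier) → (Fin n → Carrier) → Carrier
  u · v = ∑ (λ t → u t * v t)

  ∑≡sum : ∀ {m} (f : Fin m → Carrier) → ∑ f ≡ sum f
  ∑≡sum {zero} f = ≡.refl
  ∑≡sum {suc m} f = ≡.cong (f zero +_) (∑≡sum (f ∘ suc))

  ∑-cong : ∀ {m} {f g : Fin m → Carrier} → (∀ j → f j ≈ g j) → ∑ f ≈ ∑ g
  ∑-cong {f = f} {g} f≈g = trans (reflexive (∑≡sum f)) (trans (sum-cong-≋ f≈g) (reflexive (≡.sym (∑≡sum g))))

  ∑-zero : ∀ {m} {f : Fin m → Carrier} → (∀ j → f j ≈ 0#) → ∑ f ≈ 0#
  ∑-zero {zero} eq = refl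
  ∑-zero {suc m} eq = trans (+-cong (eq zero) (∑-zero (eq ∘ suc))) (+-identityˡ 0#)

  ∑-distrib-+ : ∀ {m} (f g : Fin m → Carrier) → ∑ (λ j → f j + g j) ≈ ∑ f + ∑ g
  ∑-distrib-+ f g = trans (reflexive (∑≡sum (λ j → f j + g j)))
    (trans (sum-distrib-+ f g) (+-cong (reflexive (≡.sym (∑≡sum f))) (reflexive (≡.sym (∑≡sum g)))))

  *-distribˡ-∑ : ∀ {m} c (f : Fin m → Carrier) → c * ∑ f ≈ ∑ (λ j → c * f j)
  *-distribˡ-∑ c f = trans (*-congˡ (reflexive (∑≡sum f)))
    (trans (*-distribˡ-sum c f) (reflexive (≡.sym (∑≡sum (λ j → c * f j)))))

  *-distribʳ-∑ : ∀ {m} c (f : Fin m → Carrier) → ∑ f * c ≈ ∑ (λ j → f j * c)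
  *-distribʳ-∑ c f = trans (*-congʳ (reflexive (∑≡sum f)))
    (trans (*-distribʳ-sum c f) (reflexive (≡.sym (∑≡sum (λ j → f j * c)))))

  -‿distrib-∑ : ∀ {m} (f : Fin m → Carrier) → - ∑ f ≈ ∑ (λ j → - f j)
  -‿distrib-∑ {zero} f = -0#≈0#
  -‿distrib-∑ {suc m} f = trans (sym (⁻¹-∙-comm (f zero) (∑ (f ∘ suc)))) (+-congˡ (-‿distrib-∑ (f ∘ suc)))

  ∑-comm : ∀ {m n} (f : Fin m → Fin n → Carrier) → ∑ (λ i → ∑ (f i)) ≈ ∑ (λ j → ∑ (λ i → f i j))
  ∑-comm {m} {n} f = begin
    ∑ (λ i → ∑ (f i))                ≈⟨ ∑-cong (λ i → reflexive (∑≡sum (f i))) ⟩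
    ∑ (λ i → sum (f i))              ≈⟨ reflexive (∑≡sum (λ i → sum (f i))) ⟩
    sum (λ i → sum (f i))            ≈⟨ sum-comm f ⟩
    sum (λ j → sum (λ i → f i j))    ≈⟨ reflexive (≡.sym (∑≡sum (λ j → sum (λ i → f i j)))) ⟩
    ∑ (λ j → sum (λ i → f i j))      ≈⟨ ∑-cong (λ j → reflexive (≡.sym (∑≡sum (λ i → f i j)))) ⟩
    ∑ (λ j → ∑ (λ i → f i j))        ∎

  ∑-remove : ∀ {m} (t : Fin (suc m)) (f : Fin (suc m) → Carrier) → ∑ f ≈ f t + ∑ (removeAt f t)
  ∑-remove t f = trans (reflexive (∑≡sum f))
    (trans (sum-remove f) (+-congˡ (reflexive (≡.sym (∑≡sum (removeAt f t))))))

  ∑-single : ∀ {m} (t : Fin m) (f : Fin m → Carrier) → (∀ j → j ≢ t → f j ≈ 0#) → ∑ f ≈ f t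
  ∑-single {suc m} t f rest = begin
    ∑ f                        ≈⟨ ∑-remove t f ⟩
    f t + ∑ (removeAt f t)     ≈⟨ +-congˡ (∑-zero (λ u → rest (punchIn t u) (Fin.punchInᵢ≢i t u))) ⟩
    f t + 0#                   ≈⟨ +-identityʳ (f t) ⟩
    f t                        ∎

  ∑-·-linear : ∀ {m n} (β : Fin m → Carrier) (g : Fin n → Carrier) (a : Fin m → Fin n → Carrier) →
               ∑ (λ s → β s * (g · a s)) ≈ g · (λ u → ∑ (λ s → β s * a s u))
  ∑-·-linear β g a = begin
    ∑ (λ s → β s * (g · a s))                ≈⟨ ∑-cong (λ s → *-distribˡ-∑ (β s) (λ u → g u * a s u)) ⟩
    ∑ (λ s → ∑ (λ u → β s * (g u * a s u)))  ≈⟨ ∑-comm (λ s u → β s * (g u * a s u)) ⟩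
    ∑ (λ u → ∑ (λ s → β s * (g u * a s u)))  ≈⟨ ∑-cong (λ u → ∑-cong (λ s → x∙yz≈y∙xz (β s) (g u) (a s u))) ⟩
    ∑ (λ u → ∑ (λ s → g u * (β s * a s u)))  ≈⟨ ∑-cong (λ u → sym (*-distribˡ-∑ (g u) (λ s → β s * a s u))) ⟩
    g · (λ u → ∑ (λ s → β s * a s u))        ∎

  δ-diag : ∀ {X : Set} (dec : DecidableEquality X) x → δ F dec x x ≡ 1#
  δ-diag dec x with dec x x
  ... | yes _ = ≡.refl
  ... | no x≢x = ⊥-elim (x≢x ≡.refl)

  δ-offdiag : ∀ {X : Set} (dec : DecidableEquality X) {x y} → x ≢ y → δ F dec x y ≡ 0#
  δ-offdiag dec {x} {y} x≢y with dec x y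
  ... | yes x≡y = ⊥-elim (x≢y x≡y)
  ... | no _ = ≡.refl

  δ-comm : ∀ {X : Set} (dec : DecidableEquality X) x y → δ F dec x y ≡ δ F dec y x
  δ-comm dec x y with dec x y | dec y x
  ... | yes _ | yes _ = ≡.refl
  ... | no _ | no _ = ≡.refl
  ... | yes ≡.refl | no x≢x = ⊥-elim (x≢x ≡.refl)
  ... | no x≢y | yes ≡.refl = ⊥-elim (x≢y ≡.refl)

  δᶠ : ∀ {m} → Fin m → Fin m → Carrier
  δᶠ = δ F Fin._≟_

  δᴵ : ∀ {ℓ} {ns : Fin ℓ → ℕ} → Idx ns → Idx ns → Carrier
  δᴵ = δ F (≡-dec Fin._≟_ Fin._≟_)

  ∑-δˡ : ∀ {m} (i : Fin m) (f : Fin m → Carrier) → ∑ (λ j → δᶠ i j * f j) ≈ f i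
  ∑-δˡ i f = begin
    ∑ (λ j → δᶠ i j * f j)   ≈⟨ ∑-single i _ (λ j j≢i → trans (*-congʳ (reflexive (δ-offdiag Fin._≟_ (j≢i ∘ ≡.sym)))) (zeroˡ (f j))) ⟩
    δᶠ i i * f i             ≈⟨ *-congʳ (reflexive (δ-diag Fin._≟_ i)) ⟩
    1# * f i                 ≈⟨ *-identityˡ (f i) ⟩
    f i                      ∎

  ∑-δʳ : ∀ {m} (i : Fin m) (f : Fin m → Carrier) → ∑ (λ j → f j * δᶠ j i) ≈ f i
  ∑-δʳ i f = begin
    ∑ (λ j → f j * δᶠ j i)   ≈⟨ ∑-single i _ (λ j j≢i → trans (*-congˡ (reflexive (δ-offdiag Fin._≟_ j≢i))) (zeroʳ (f j))) ⟩
    f i * δᶠ i i             ≈⟨ *-congˡ (reflexive (δ-diag Fin._≟_ i)) ⟩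
    f i * 1#                 ≈⟨ *-identityʳ (f i) ⟩
    f i                      ∎

  module _ {ℓ} (ns : Fin ℓ → ℕ) where

    ∑ᴵ-cong : {f g : Idx ns → Carrier} → (∀ p → f p ≈ g p) → ∑ᴵ ns f ≈ ∑ᴵ ns g
    ∑ᴵ-cong eq = ∑-cong (λ i → ∑-cong (λ t → eq (i , t)))

    ∑ᴵ-zero : {f : Idx ns → Carrier} → (∀ p → f p ≈ 0#) → ∑ᴵ ns f ≈ 0#
    ∑ᴵ-zero eq = ∑-zero (λ i → ∑-zero (λ t → eq (i , t)))

    *-distribˡ-∑ᴵ : ∀ c (f : Idx ns → Carrier) → c * ∑ᴵ ns f ≈ ∑ᴵ ns (λ p → c * f p)
    *-distribˡ-∑ᴵ c f =
      trans (*-distribˡ-∑ c (λ i → ∑ (λ t → f (i , t)))) (∑-cong (λ i → *-distribˡ-∑ c (λ t → f (i , t))))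

    *-distribʳ-∑ᴵ : ∀ c (f : Idx ns → Carrier) → ∑ᴵ ns f * c ≈ ∑ᴵ ns (λ p → f p * c)
    *-distribʳ-∑ᴵ c f =
      trans (*-distribʳ-∑ c (λ i → ∑ (λ t → f (i , t)))) (∑-cong (λ i → *-distribʳ-∑ c (λ t → f (i , t))))

    ∑-∑ᴵ-comm : ∀ {m} (f : Fin m → Idx ns → Carrier) → ∑ (λ r → ∑ᴵ ns (f r)) ≈ ∑ᴵ ns (λ p → ∑ (λ r → f r p))
    ∑-∑ᴵ-comm f = trans (∑-comm (λ r i → ∑ (λ t → f r (i , t)))) (∑-cong (λ i → ∑-comm (λ r t → f r (i , t))))

    ∑ᴵ-single : ∀ q (f : Idx ns → Carrier) → (∀ p → p ≢ q → f p ≈ 0#) → ∑ᴵ ns f ≈ f q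
    ∑ᴵ-single (i , t) f rest =
      trans (∑-single i _ (λ i′ i′≢i → ∑-zero (λ t′ → rest (i′ , t′) (i′≢i ∘ ≡.cong proj₁))))
            (∑-single t _ (λ t′ t′≢t → rest (i , t′) (t′≢t ∘ snd-≡)))
      where
      snd-≡ : ∀ {t′} → (i , t′) ≡ (i , t) → t′ ≡ t
      snd-≡ ≡.refl = ≡.refl

    ∑ᴵ-δʳ : ∀ q (f : Idx ns → Carrier) → ∑ᴵ ns (λ p → f p * δᴵ p q) ≈ f q
    ∑ᴵ-δʳ q f = begin
      ∑ᴵ ns (λ p → f p * δᴵ p q)   ≈⟨ ∑ᴵ-single q _ (λ p p≢q → trans (*-congˡ (reflexive (δ-offdiag (≡-dec Fin._≟_ Fin._≟_) p≢q))) (zeroʳ (f p))) ⟩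
      f q * δᴵ q q                 ≈⟨ *-congˡ (reflexive (δ-diag (≡-dec Fin._≟_ Fin._≟_) q)) ⟩
      f q * 1#                     ≈⟨ *-identityʳ (f q) ⟩
      f q                          ∎

  δ-reindex : ∀ {m n} (σ : Fin m → Fin n) → (∀ {s s′} → σ s ≡ σ s′ → s ≡ s′) → ∀ s s′ → δᶠ (σ s) (σ s′) ≡ δᶠ s s′
  δ-reindex σ σ-injective s s′ with s Fin.≟ s′ | σ s Fin.≟ σ s′
  ... | yes _ | yes _ = ≡.refl
  ... | no _ | no _ = ≡.refl
  ... | yes ≡.refl | no σs≢σs = ⊥-elim (σs≢σs ≡.refl)
  ... | no s≢s′ | yes σs≡σs′ = ⊥-elim (s≢s′ (σ-injective σs≡σs′))

  ·-comm : ∀ {n} (u v : Fin n → Carrier) → u · v ≈ v · u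
  ·-comm u v = ∑-cong (λ t → *-comm (u t) (v t))

module LinearAlgebra (F : FiniteField) where
  open FiniteField F using (commRing; 0≉1; inverse; _≈?_)
  open CommutativeRing commRing hiding (zero)
  open import Relation.Binary.Reasoning.Setoid setoid
  open RingProperties ring using (-0#≈0#)
  open CommutativeRingSolver commRing using (solve; _:=_; _:+_; _:*_; :-_)
  open FiniteSums F

  1≉0 : ¬ 1# ≈ 0#
  1≉0 = 0≉1 ∘ sym

  nonzero-cancelˡ : ∀ {a b} → ¬ a ≈ 0# → a * b ≈ 0# → b ≈ 0#
  nonzero-cancelˡ {a} {b} a≉0 ab≈0 with inverse a a≉0
  ... | a⁻¹ , aa⁻¹≈1 = begin
    b                ≈⟨ sym (*-identityˡ b) ⟩
    1# * b           ≈⟨ *-congʳ (trans (sym aa⁻¹≈1) (*-comm a a⁻¹)) ⟩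
    (a⁻¹ * a) * b    ≈⟨ *-assoc a⁻¹ a b ⟩
    a⁻¹ * (a * b)    ≈⟨ *-congˡ ab≈0 ⟩
    a⁻¹ * 0#         ≈⟨ zeroʳ a⁻¹ ⟩
    0#               ∎

  zero-or-nonzero : ∀ {n} (f : Fin n → Carrier) → (∀ t → f t ≈ 0#) ⊎ ∃[ t ] ¬ f t ≈ 0#
  zero-or-nonzero {zero} f = inj₁ λ ()
  zero-or-nonzero {suc n} f with f zero ≈? 0# | zero-or-nonzero (f ∘ suc)
  ... | no f₀≉0 | _ = inj₂ (zero , f₀≉0)
  ... | yes _ | inj₂ (t , fₜ≉0) = inj₂ (suc t , fₜ≉0)
  ... | yes f₀≈0 | inj₁ rest≈0 = inj₁ λ { zero → f₀≈0 ; (suc t) → rest≈0 t }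

  solve-for : ∀ {a ι x y} → a * ι ≈ 1# → a * x + y ≈ 0# → x ≈ - (ι * y)
  solve-for {a} {ι} {x} {y} aι≈1 ax+y≈0 = sym (begin
    - (ι * y)                          ≈⟨ solve 4 (λ a ι x y → :- (ι :* y) := :- (ι :* (a :* x :+ y)) :+ x :* (a :* ι)) refl a ι x y ⟩
    - (ι * (a * x + y)) + x * (a * ι)  ≈⟨ +-cong (-‿cong (*-congˡ ax+y≈0)) (*-congˡ aι≈1) ⟩
    - (ι * 0#) + x * 1#                ≈⟨ +-cong (trans (-‿cong (zeroʳ ι)) -0#≈0#) (*-identityʳ x) ⟩
    0# + x                             ≈⟨ +-identityˡ x ⟩
    x                                  ∎)

  unitVectors-indep : ∀ (P : Carrier → Set) {m n} (σ : Fin m → Fin n) → (∀ {s s′} → σ s ≡ σ s′ → s ≡ s′) →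
                      LinIndep F P (λ s → δᶠ (σ s))
  unitVectors-indep P σ σ-injective b _ Σbδ≈0 s = begin
    b s                               ≈⟨ sym (∑-δʳ s b) ⟩
    ∑ (λ s′ → b s′ * δᶠ s′ s)         ≈⟨ ∑-cong (λ s′ → *-congˡ (reflexive (≡.sym (δ-reindex σ σ-injective s′ s)))) ⟩
    ∑ (λ s′ → b s′ * δᶠ (σ s′) (σ s)) ≈⟨ Σbδ≈0 (σ s) ⟩
    0#                                ∎

  singleton-indep : ∀ {X : Set} (c : X → Carrier) → (∀ b → (∀ x → b * c x ≈ 0#) → b ≈ 0#) →
                    LinIndep F (λ _ → ⊤) {1} (λ _ → c)
  singleton-indep c only-trivial b _ bc≈0 zero = only-trivial (b zero) (λ x → trans (sym (+-identityʳ _)) (bc≈0 x))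

  zeroRow-¬indep : ∀ (P : Carrier → Set) {d} {X : Set} (w : Fin d → X → Carrier) r →
                   (∀ r′ → P (δᶠ r r′)) → (∀ x → w r x ≈ 0#) → ¬ LinIndep F P w
  zeroRow-¬indep P w r P-δ wᵣ≈0 w-indep =
    1≉0 (trans (sym (reflexive (δ-diag Fin._≟_ r)))
               (w-indep (δᶠ r) P-δ (λ x → trans (∑-δˡ r (λ r′ → w r′ x)) (wᵣ≈0 x)) r))

  rowSpace-⊥ : ∀ (P : Carrier → Set) {m n} (M : Fin m → Fin n → Carrier) {α v} → RowSpace F P M v →
               (∀ j → α · M j ≈ 0#) → α · v ≈ 0#
  rowSpace-⊥ P M {α} {v} (β , _ , v≈ΣβM) α⊥M = begin
    α · v                                  ≈⟨ ∑-cong (λ t → *-congˡ (v≈ΣβM t)) ⟩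
    α · (λ t → ∑ (λ j → β j * M j t))      ≈⟨ sym (∑-·-linear β α M) ⟩
    ∑ (λ j → β j * (α · M j))              ≈⟨ ∑-zero (λ j → trans (*-congˡ (α⊥M j)) (zeroʳ (β j))) ⟩
    0#                                     ∎

module SubfieldLinearAlgebra (F : FiniteField) (S : Subfield F) where
  open FiniteField F using (commRing; inverse)
  open CommutativeRing commRing hiding (zero)
  open import Relation.Binary.Reasoning.Setoid setoid
  open CommutativeRingSolver commRing using (solve; _:=_; _:+_; _:*_; :-_; _:-_)
  open RingProperties ring using (-0#≈0#)
  open FiniteSums F
  open LinearAlgebra F
  open Subfield S

  K-∑ : ∀ {m} {f : Fin m → Carrier} → (∀ j → K (f j)) → K (∑ f)
  K-∑ {zero} _ = K-0
  K-∑ {suc m} K-f = K-+ (K-f zero) (K-∑ (K-f ∘ suc))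

  K-δ : ∀ {X : Set} (dec : DecidableEquality X) x y → K (δ F dec x y)
  K-δ dec x y with dec x y
  ... | yes _ = K-1
  ... | no _ = K-0

  K-insertAt : ∀ {n} {f : Fin n → Carrier} (t : Fin (suc n)) {x} → K x → (∀ u → K (f u)) →
               ∀ u → K (insertAt f t x u)
  K-insertAt {f = f} t {x} K-x K-f u with pivot-or-punchIn t u
  ... | inj₁ ≡.refl = ≡.subst K (≡.sym (Vector.insertAt-lookup f t x)) K-x
  ... | inj₂ (u′ , ≡.refl) = ≡.subst K (≡.sym (Vector.insertAt-punchIn f t x u′)) (K-f u′)

  LinIndep-reindex : ∀ {m′ m} {X : Set} (a : Fin m → X → Carrier) (σ : Fin m′ → Fin m) →
                     (∀ {s s′} → σ s ≡ σ s′ → s ≡ s′) → LinIndep F K a → LinIndep F K (a ∘ σ)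
  LinIndep-reindex {m′} a σ σ-injective a-indep b K-b Σb·aσ≈0 s = begin
    b s       ≈⟨ sym b′-σ ⟩
    b′ (σ s)  ≈⟨ a-indep b′ (λ r → K-∑ (λ s′ → K-* (K-b s′) (K-δ Fin._≟_ (σ s′) r))) Σb′·a≈0 (σ s) ⟩
    0#        ∎
    where
    b′ : Fin _ → Carrier
    b′ r = ∑ (λ s′ → b s′ * δᶠ (σ s′) r)

    b′-σ : b′ (σ s) ≈ b s
    b′-σ = trans (∑-cong (λ s′ → *-congˡ (reflexive (δ-reindex σ σ-injective s′ s)))) (∑-δʳ s b)

    Σb′·a≈0 : ∀ x → ∑ (λ r → b′ r * a r x) ≈ 0#
    Σb′·a≈0 x = begin
      ∑ (λ r → b′ r * a r x)                              ≈⟨ ∑-cong (λ r → *-distribʳ-∑ (a r x) (λ s′ → b s′ * δᶠ (σ s′) r)) ⟩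
      ∑ (λ r → ∑ (λ s′ → (b s′ * δᶠ (σ s′) r) * a r x))   ≈⟨ ∑-comm (λ r s′ → (b s′ * δᶠ (σ s′) r) * a r x) ⟩
      ∑ (λ s′ → ∑ (λ r → (b s′ * δᶠ (σ s′) r) * a r x))   ≈⟨ ∑-cong (λ s′ → ∑-cong (λ r → *-assoc (b s′) (δᶠ (σ s′) r) (a r x))) ⟩
      ∑ (λ s′ → ∑ (λ r → b s′ * (δᶠ (σ s′) r * a r x)))   ≈⟨ ∑-cong (λ s′ → sym (*-distribˡ-∑ (b s′) (λ r → δᶠ (σ s′) r * a r x))) ⟩
      ∑ (λ s′ → b s′ * ∑ (λ r → δᶠ (σ s′) r * a r x))     ≈⟨ ∑-cong (λ s′ → *-congˡ (∑-δˡ (σ s′) (λ r → a r x))) ⟩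
      ∑ (λ s′ → b s′ * a (σ s′) x)                        ≈⟨ Σb·aσ≈0 x ⟩
      0#                                                  ∎

  record Complement {d n} (w : Fin d → Fin n → Carrier) : Set where
    field
      space : Subspace F S n
    open Subspace space public
    field
      orthogonal : ∀ j r → w j · basis r ≈ 0#
      spanning   : ∀ v → (∀ t → K (v t)) → (∀ j → w j · v ≈ 0#) → RowSpace F K basis v
      dim-lower  : n ≤ dim ℕ.+ d
      dim-upper  : LinIndep F K w → dim ℕ.+ d ≤ n

  standardComplement : ∀ n (w : Fin 0 → Fin n → Carrier) → Complement w
  standardComplement n w = record
    { space = record
      { dim = n ; basis = δᶠ ; basis-K = K-δ Fin._≟_ ; basis-indep = unitVectors-indep K (λ t → t) (λ eq → eq) }
    ; orthogonal = λ ()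
    ; spanning = λ v K-v _ → v , K-v , (λ t → sym (∑-δʳ t v))
    ; dim-lower = ℕ.≤-reflexive (≡.sym (ℕ.+-identityʳ n))
    ; dim-upper = λ _ → ℕ.≤-reflexive (ℕ.+-identityʳ n)
    }

  dropZeroRow : ∀ {d n} (w : Fin (suc d) → Fin n → Carrier) → (∀ u → w zero u ≈ 0#) →
                Complement (w ∘ suc) → Complement w
  dropZeroRow {d} w w₀≈0 C = record
    { space = space
    ; orthogonal = λ { zero r → ∑-zero (λ u → trans (*-congʳ (w₀≈0 u)) (zeroˡ _)) ; (suc j) r → orthogonal j r }
    ; spanning = λ v K-v ⊥v → spanning v K-v (⊥v ∘ suc)
    ; dim-lower = ℕ.≤-trans dim-lower (ℕ.+-monoʳ-≤ dim (ℕ.n≤1+n d))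
    ; dim-upper = λ w-indep → ⊥-elim (zeroRow-¬indep K w zero (K-δ Fin._≟_ zero) w₀≈0 w-indep)
    }
    where open Complement C

  -- Gaussian elimination on the pivot w₀ₜ ≠ 0: the rows w₁, w₂, … are cleared at t, and a
  -- vector orthogonal to w₀ is recovered from its other coordinates by solving w₀ · v = 0 for vₜ.
  module PivotStep {d n} (w : Fin (suc d) → Fin (suc n) → Carrier) (w-K : ∀ j u → K (w j u))
                   (t : Fin (suc n)) (w₀ₜ≉0 : ¬ w zero t ≈ 0#) where

    ι : Carrier
    ι = proj₁ (inverse (w zero t) w₀ₜ≉0)

    w₀ₜι≈1 : w zero t * ι ≈ 1#
    w₀ₜι≈1 = proj₂ (inverse (w zero t) w₀ₜ≉0)

    K-ι : K ι
    K-ι = K-inv (w-K zero t) w₀ₜι≈1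

    multiplier : Fin d → Carrier
    multiplier j = w (suc j) t * ι

    eliminated : Fin d → Fin (suc n) → Carrier
    eliminated j u = w (suc j) u - multiplier j * w zero u

    reduced : Fin d → Fin n → Carrier
    reduced j = removeAt (eliminated j) t

    K-reduced : ∀ j u → K (reduced j u)
    K-reduced j u = K-+ (w-K (suc j) _) (K-neg (K-* (K-* (w-K (suc j) t) K-ι) (w-K zero _)))

    eliminated-pivot : ∀ j → eliminated j t ≈ 0#
    eliminated-pivot j = begin
      y - (y * ι) * x    ≈⟨ solve 3 (λ y ι x → y :- (y :* ι) :* x := y :- y :* (x :* ι)) refl y ι x ⟩
      y - y * (x * ι)    ≈⟨ +-congˡ (-‿cong (trans (*-congˡ w₀ₜι≈1) (*-identityʳ y))) ⟩
      y - y              ≈⟨ -‿inverseʳ y ⟩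
      0#                 ∎
      where
      x y : Carrier
      x = w zero t
      y = w (suc j) t

    eliminated-· : ∀ j x → eliminated j · x ≈ w (suc j) · x - multiplier j * (w zero · x)
    eliminated-· j x = begin
      ∑ (λ u → (a u - m * b u) * x u)                 ≈⟨ ∑-cong (λ u → solve 4 (λ a b x m → (a :- m :* b) :* x := a :* x :+ :- (m :* (b :* x))) refl (a u) (b u) (x u) m) ⟩
      ∑ (λ u → a u * x u + - (m * (b u * x u)))        ≈⟨ ∑-distrib-+ (λ u → a u * x u) (λ u → - (m * (b u * x u))) ⟩
      a · x + ∑ (λ u → - (m * (b u * x u)))           ≈⟨ +-congˡ (sym (-‿distrib-∑ (λ u → m * (b u * x u)))) ⟩
      a · x - ∑ (λ u → m * (b u * x u))               ≈⟨ +-congˡ (-‿cong (sym (*-distribˡ-∑ m (λ u → b u * x u)))) ⟩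
      a · x - m * (b · x)                             ∎
      where
      a b : Fin (suc n) → Carrier
      a = w (suc j)
      b = w zero
      m : Carrier
      m = multiplier j

    ·-reduced : ∀ x → w zero · x ≈ 0# → ∀ j → w (suc j) · x ≈ reduced j · removeAt x t
    ·-reduced x w₀⊥x j = begin
      w (suc j) · x                                    ≈⟨ sym (trans (+-congˡ (-‿cong (trans (*-congˡ w₀⊥x) (zeroʳ _)))) (trans (+-congˡ -0#≈0#) (+-identityʳ _))) ⟩
      w (suc j) · x - multiplier j * (w zero · x)      ≈⟨ sym (eliminated-· j x) ⟩
      eliminated j · x                                 ≈⟨ ∑-remove t (λ u → eliminated j u * x u) ⟩
      eliminated j t * x t + reduced j · removeAt x t  ≈⟨ +-congʳ (trans (*-congʳ (eliminated-pivot j)) (zeroˡ (x t))) ⟩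
      0# + reduced j · removeAt x t                    ≈⟨ +-identityˡ _ ⟩
      reduced j · removeAt x t                         ∎

    pivotValue : (Fin n → Carrier) → Carrier
    pivotValue v = - (ι * (removeAt (w zero) t · v))

    lift : (Fin n → Carrier) → Fin (suc n) → Carrier
    lift v = insertAt v t (pivotValue v)

    lift-pivot : ∀ v → lift v t ≡ pivotValue v
    lift-pivot v = Vector.insertAt-lookup v t (pivotValue v)

    lift-punchIn : ∀ v u → lift v (punchIn t u) ≡ v u
    lift-punchIn v = Vector.insertAt-punchIn v t (pivotValue v)

    ·-lift : ∀ v → w zero · lift v ≈ 0#
    ·-lift v = begin
      w zero · lift v                                          ≈⟨ ∑-remove t (λ u → w zero u * lift v u) ⟩
      x * lift v t + ∑ (λ u → g u * lift v (punchIn t u))      ≈⟨ +-cong (*-congˡ (reflexive (lift-pivot v))) (∑-cong (λ u → *-congˡ (reflexive (lift-punchIn v u)))) ⟩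
      x * - (ι * (g · v)) + g · v                              ≈⟨ solve 3 (λ x ι s → x :* (:- (ι :* s)) :+ s := s :- (x :* ι) :* s) refl x ι (g · v) ⟩
      g · v - (x * ι) * (g · v)                                ≈⟨ +-congˡ (-‿cong (trans (*-congʳ w₀ₜι≈1) (*-identityˡ _))) ⟩
      g · v - g · v                                            ≈⟨ -‿inverseʳ _ ⟩
      0#                                                       ∎
      where
      x : Carrier
      x = w zero t
      g : Fin n → Carrier
      g = removeAt (w zero) t

    lift-removeAt : ∀ v → w zero · v ≈ 0# → ∀ u → v u ≈ lift (removeAt v t) u
    lift-removeAt v w₀⊥v u with pivot-or-punchIn t u
    ... | inj₂ (u′ , ≡.refl) = reflexive (≡.sym (lift-punchIn (removeAt v t) u′))
    ... | inj₁ ≡.refl = begin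
      v t                      ≈⟨ solve-for w₀ₜι≈1 (trans (sym (∑-remove t (λ u → w zero u * v u))) w₀⊥v) ⟩
      pivotValue (removeAt v t) ≈⟨ reflexive (≡.sym (lift-pivot (removeAt v t))) ⟩
      lift (removeAt v t) t    ∎

    lift-cong : ∀ {v v′} → (∀ u → v u ≈ v′ u) → ∀ u → lift v u ≈ lift v′ u
    lift-cong {v} {v′} v≈v′ u with pivot-or-punchIn t u
    ... | inj₁ ≡.refl = begin
      lift v t       ≈⟨ reflexive (lift-pivot v) ⟩
      pivotValue v   ≈⟨ -‿cong (*-congˡ (∑-cong (λ u → *-congˡ (v≈v′ u)))) ⟩
      pivotValue v′  ≈⟨ reflexive (≡.sym (lift-pivot v′)) ⟩
      lift v′ t      ∎
    ... | inj₂ (u′ , ≡.refl) = begin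
      lift v (punchIn t u′)    ≈⟨ reflexive (lift-punchIn v u′) ⟩
      v u′                     ≈⟨ v≈v′ u′ ⟩
      v′ u′                    ≈⟨ reflexive (≡.sym (lift-punchIn v′ u′)) ⟩
      lift v′ (punchIn t u′)   ∎

    lift-linear : ∀ {m} (β : Fin m → Carrier) (a : Fin m → Fin n → Carrier) u →
                  ∑ (λ s → β s * lift (a s) u) ≈ lift (λ u′ → ∑ (λ s → β s * a s u′)) u
    lift-linear β a u with pivot-or-punchIn t u
    ... | inj₂ (u′ , ≡.refl) = begin
      ∑ (λ s → β s * lift (a s) (punchIn t u′))          ≈⟨ ∑-cong (λ s → *-congˡ (reflexive (lift-punchIn (a s) u′))) ⟩
      ∑ (λ s → β s * a s u′)                             ≈⟨ reflexive (≡.sym (lift-punchIn (λ u″ → ∑ (λ s → β s * a s u″)) u′)) ⟩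
      lift (λ u″ → ∑ (λ s → β s * a s u″)) (punchIn t u′) ∎
    ... | inj₁ ≡.refl = begin
      ∑ (λ s → β s * lift (a s) t)                       ≈⟨ ∑-cong (λ s → *-congˡ (reflexive (lift-pivot (a s)))) ⟩
      ∑ (λ s → β s * - (ι * (g · a s)))                  ≈⟨ ∑-cong (λ s → solve 3 (λ b i q → b :* (:- (i :* q)) := :- (i :* (b :* q))) refl (β s) ι (g · a s)) ⟩
      ∑ (λ s → - (ι * (β s * (g · a s))))                ≈⟨ sym (-‿distrib-∑ (λ s → ι * (β s * (g · a s)))) ⟩
      - ∑ (λ s → ι * (β s * (g · a s)))                  ≈⟨ -‿cong (sym (*-distribˡ-∑ ι (λ s → β s * (g · a s)))) ⟩
      - (ι * ∑ (λ s → β s * (g · a s)))                  ≈⟨ -‿cong (*-congˡ (∑-·-linear β g a)) ⟩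
      pivotValue (λ u′ → ∑ (λ s → β s * a s u′))          ≈⟨ reflexive (≡.sym (lift-pivot (λ u′ → ∑ (λ s → β s * a s u′)))) ⟩
      lift (λ u′ → ∑ (λ s → β s * a s u′)) t              ∎
      where
      g : Fin n → Carrier
      g = removeAt (w zero) t

    reduced-indep : LinIndep F K w → LinIndep F K reduced
    reduced-indep w-indep b K-b Σb·reduced≈0 j = w-indep b′ K-b′ Σb′·w≈0 (suc j)
      where
      b′ : Fin (suc d) → Carrier
      b′ zero = - ∑ (λ j → b j * multiplier j)
      b′ (suc j) = b j

      K-b′ : ∀ r → K (b′ r)
      K-b′ zero = K-neg (K-∑ (λ j → K-* (K-b j) (K-* (w-K (suc j) t) K-ι)))
      K-b′ (suc j) = K-b j

      combination : ∀ x → ∑ (λ r → b′ r * w r x) ≈ ∑ (λ j → b j * eliminated j x)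
      combination x = sym (begin
        ∑ (λ j → b j * eliminated j x)
          ≈⟨ ∑-cong (λ j → solve 4 (λ b a m c → b :* (a :- m :* c) := b :* a :+ (:- (b :* m)) :* c) refl (b j) (w (suc j) x) (multiplier j) (w zero x)) ⟩
        ∑ (λ j → b j * w (suc j) x + - (b j * multiplier j) * w zero x)
          ≈⟨ ∑-distrib-+ (λ j → b j * w (suc j) x) (λ j → - (b j * multiplier j) * w zero x) ⟩
        ∑ (λ j → b j * w (suc j) x) + ∑ (λ j → - (b j * multiplier j) * w zero x)
          ≈⟨ +-congˡ (sym (*-distribʳ-∑ (w zero x) (λ j → - (b j * multiplier j)))) ⟩
        ∑ (λ j → b j * w (suc j) x) + ∑ (λ j → - (b j * multiplier j)) * w zero x
          ≈⟨ +-comm _ _ ⟩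
        ∑ (λ j → - (b j * multiplier j)) * w zero x + ∑ (λ j → b j * w (suc j) x)
          ≈⟨ +-congʳ (*-congʳ (sym (-‿distrib-∑ (λ j → b j * multiplier j)))) ⟩
        b′ zero * w zero x + ∑ (λ j → b j * w (suc j) x)
          ∎)

      Σb′·w≈0 : ∀ x → ∑ (λ r → b′ r * w r x) ≈ 0#
      Σb′·w≈0 x with pivot-or-punchIn t x
      ... | inj₁ ≡.refl = trans (combination t) (∑-zero (λ j → trans (*-congˡ (eliminated-pivot j)) (zeroʳ (b j))))
      ... | inj₂ (u , ≡.refl) = trans (combination (punchIn t u)) (Σb·reduced≈0 u)

    extend : Complement reduced → Complement w
    extend C = record
      { space = record
        { dim = dim
        ; basis = lift ∘ basis
        ; basis-K = λ r → K-insertAt t (K-neg (K-* K-ι (K-∑ (λ u → K-* (w-K zero _) (basis-K r u))))) (basis-K r)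
        ; basis-indep = λ b K-b Σb·lift≈0 → basis-indep b K-b (λ u →
            trans (∑-cong (λ r → *-congˡ (reflexive (≡.sym (lift-punchIn (basis r) u))))) (Σb·lift≈0 (punchIn t u)))
        }
      ; orthogonal = λ
          { zero r → ·-lift (basis r)
          ; (suc j) r → trans (·-reduced (lift (basis r)) (·-lift (basis r)) j)
                              (trans (∑-cong (λ u → *-congˡ (reflexive (lift-punchIn (basis r) u)))) (orthogonal j r))
          }
      ; spanning = spans
      ; dim-lower = ℕ.≤-trans (s≤s dim-lower) (ℕ.≤-reflexive (≡.sym (ℕ.+-suc dim d)))
      ; dim-upper = λ w-indep → ℕ.≤-trans (ℕ.≤-reflexive (ℕ.+-suc dim d)) (s≤s (dim-upper (reduced-indep w-indep)))
      }
      where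
      open Complement C

      spans : ∀ v → (∀ u → K (v u)) → (∀ j → w j · v ≈ 0#) → RowSpace F K (lift ∘ basis) v
      spans v K-v w⊥v = β , K-β , λ u → begin
        v u                                        ≈⟨ lift-removeAt v (w⊥v zero) u ⟩
        lift (removeAt v t) u                      ≈⟨ lift-cong v′≈Σβ·basis u ⟩
        lift (λ u′ → ∑ (λ r → β r * basis r u′)) u  ≈⟨ sym (lift-linear β basis u) ⟩
        ∑ (λ r → β r * lift (basis r) u)           ∎
        where
        reduced⊥v′ : ∀ j → reduced j · removeAt v t ≈ 0#
        reduced⊥v′ j = trans (sym (·-reduced v (w⊥v zero) j)) (w⊥v (suc j))
        v′∈span : RowSpace F K basis (removeAt v t)
        v′∈span = spanning (removeAt v t) (K-v ∘ punchIn t) reduced⊥v′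
        β : Fin dim → Carrier
        β = proj₁ v′∈span
        K-β : ∀ r → K (β r)
        K-β = proj₁ (proj₂ v′∈span)
        v′≈Σβ·basis : ∀ u → removeAt v t u ≈ ∑ (λ r → β r * basis r u)
        v′≈Σβ·basis = proj₂ (proj₂ v′∈span)

  complement : ∀ {d n} (w : Fin d → Fin n → Carrier) → (∀ j u → K (w j u)) → Complement w
  complement {zero} {n} w _ = standardComplement n w
  complement {suc d} {zero} w w-K = dropZeroRow w (λ ()) (complement (w ∘ suc) (w-K ∘ suc))
  complement {suc d} {suc n} w w-K with zero-or-nonzero (w zero)
  ... | inj₁ w₀≈0 = dropZeroRow w w₀≈0 (complement (w ∘ suc) (w-K ∘ suc))
  ... | inj₂ (t , w₀ₜ≉0) = extend (complement reduced K-reduced)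
    where open PivotStep w w-K t w₀ₜ≉0

module SquareMatrices (F : FiniteField) where
  open FiniteField F using (commRing; inverse; _≈?_)
  open CommutativeRing commRing hiding (zero)
  open import Relation.Binary.Reasoning.Setoid setoid
  open RingProperties ring using (-‿distribˡ-*)
  open import Algebra.Properties.Group +-group using (x∙y⁻¹≈ε⇒x≈y)
  open FiniteSums F
  open LinearAlgebra F

  fullSubfield : Subfield F
  fullSubfield = record
    { K = λ _ → ⊤ ; K-resp = λ _ _ → tt ; K-0 = tt ; K-1 = tt ; K-+ = λ _ _ → tt
    ; K-neg = λ _ → tt ; K-* = λ _ _ → tt ; K-inv = λ _ _ → tt }

  open SubfieldLinearAlgebra F fullSubfield using (Complement; complement)

  -- The complement of the n coordinate functionals of the vectors has dimension ≥ r - n > 0.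
  n<r⇒dependent : ∀ {r n} (v : Fin r → Fin n → Carrier) → n < r →
                  ∃[ α ] (∀ x → ∑ (λ s → α s * v s x) ≈ 0#) × ∃[ s ] ¬ α s ≈ 0#
  n<r⇒dependent {r} {n} v n<r = α , α-relation , nonzeroEntry
    where
    open Complement (complement (λ x s → v s x) (λ _ _ → tt))
    first : Fin dim
    first = Fin.fromℕ< (ℕ.+-cancelʳ-< n 0 dim (ℕ.<-≤-trans n<r dim-lower))
    α : Fin r → Carrier
    α = basis first
    α-relation : ∀ x → ∑ (λ s → α s * v s x) ≈ 0#
    α-relation x = trans (·-comm α (λ s → v s x)) (orthogonal x first)
    nonzeroEntry : ∃[ s ] ¬ α s ≈ 0#
    nonzeroEntry with zero-or-nonzero α
    ... | inj₂ α≉0 = α≉0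
    ... | inj₁ α≈0 = ⊥-elim (zeroRow-¬indep (λ _ → ⊤) basis first (λ _ → tt) α≈0 basis-indep)

  sumℕ<⇒dependent : ∀ {ℓ r} (ns : Fin ℓ → ℕ) (v : Fin r → Idx ns → Carrier) → sumℕ ns < r →
                    ∃[ α ] (∀ p → ∑ (λ s → α s * v s p) ≈ 0#) × ∃[ s ] ¬ α s ≈ 0#
  sumℕ<⇒dependent ns v N<r =
    let (α , α-relation , α≉0) = n<r⇒dependent (λ s → v s ∘ toIdx ns) N<r
    in α , (λ p → ≡.subst (λ p′ → ∑ (λ s → α s * v s p′) ≈ 0#) (toIdx-fromIdx ns p) (α-relation (fromIdx ns p))) , α≉0

  indep⇒≤sumℕ : ∀ {ℓ r} (ns : Fin ℓ → ℕ) (v : Fin r → Idx ns → Carrier) → LinIndep F (λ _ → ⊤) v → r ≤ sumℕ ns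
  indep⇒≤sumℕ {r = r} ns v v-indep with r ℕ.≤? sumℕ ns
  ... | yes r≤N = r≤N
  ... | no r≰N =
    let (α , α-relation , s , αₛ≉0) = sumℕ<⇒dependent ns v (ℕ.≰⇒> r≰N)
    in ⊥-elim (αₛ≉0 (v-indep α (λ _ → tt) α-relation s))

  module _ {ℓ k} (ks : Fin ℓ → ℕ) (M : Fin k → Idx ks → Carrier) where

    Invertible⇒rows-indep : Invertible F {k} {ks = ks} M → LinIndep F (λ _ → ⊤) M
    Invertible⇒rows-indep (B , MB≈I , _) x _ xM≈0 r = begin
      x r                                          ≈⟨ sym (∑-δʳ r x) ⟩
      ∑ (λ r′ → x r′ * δᶠ r′ r)                     ≈⟨ ∑-cong (λ r′ → *-congˡ (sym (MB≈I r′ r))) ⟩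
      ∑ (λ r′ → x r′ * ∑ᴵ ks (λ q → M r′ q * B q r)) ≈⟨ ∑-cong (λ r′ → *-distribˡ-∑ᴵ ks (x r′) (λ q → M r′ q * B q r)) ⟩
      ∑ (λ r′ → ∑ᴵ ks (λ q → x r′ * (M r′ q * B q r))) ≈⟨ ∑-∑ᴵ-comm ks (λ r′ q → x r′ * (M r′ q * B q r)) ⟩
      ∑ᴵ ks (λ q → ∑ (λ r′ → x r′ * (M r′ q * B q r))) ≈⟨ ∑ᴵ-zero ks (λ q → xMB≈0 q) ⟩
      0#                                           ∎
      where
      xMB≈0 : ∀ q → ∑ (λ r′ → x r′ * (M r′ q * B q r)) ≈ 0#
      xMB≈0 q = begin
        ∑ (λ r′ → x r′ * (M r′ q * B q r))   ≈⟨ ∑-cong (λ r′ → sym (*-assoc (x r′) (M r′ q) (B q r))) ⟩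
        ∑ (λ r′ → (x r′ * M r′ q) * B q r)   ≈⟨ sym (*-distribʳ-∑ (B q r) (λ r′ → x r′ * M r′ q)) ⟩
        ∑ (λ r′ → x r′ * M r′ q) * B q r     ≈⟨ *-congʳ (xM≈0 q) ⟩
        0# * B q r                           ≈⟨ zeroˡ (B q r) ⟩
        0#                                   ∎

    -- e_q₀ and the k rows of M are k + 1 vectors in a space of dimension k; the independence
    -- of the rows forces the coefficient of e_q₀ in any relation among them to be nonzero.
    unitRow-combination : sumℕ ks ≡ k → LinIndep F (λ _ → ⊤) M → ∀ q₀ → ∃[ b ] (∀ q → ∑ (λ r → b r * M r q) ≈ δᴵ q₀ q)
    unitRow-combination Σks≡k M-indep q₀ with sumℕ<⇒dependent ks (δᴵ q₀ ∷ M) (s≤s (ℕ.≤-reflexive Σks≡k))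
    ... | α , α-relation , s , αₛ≉0 with α zero ≈? 0#
    ...   | yes α₀≈0 = ⊥-elim (αₛ≉0 (α≈0 s))
      where
      α≈0 : ∀ s → α s ≈ 0#
      α≈0 zero = α₀≈0
      α≈0 (suc r) = M-indep (α ∘ suc) (λ _ → tt) (λ q →
        trans (sym (trans (+-congʳ (trans (*-congʳ α₀≈0) (zeroˡ _))) (+-identityˡ _))) (α-relation q)) r
    ...   | no α₀≉0 = (λ r → - (ι * α (suc r))) , λ q → sym (begin
      δᴵ q₀ q                                   ≈⟨ solve-for α₀ι≈1 (α-relation q) ⟩
      - (ι * ∑ (λ r → α (suc r) * M r q))         ≈⟨ -‿cong (*-distribˡ-∑ ι (λ r → α (suc r) * M r q)) ⟩
      - ∑ (λ r → ι * (α (suc r) * M r q))         ≈⟨ -‿distrib-∑ (λ r → ι * (α (suc r) * M r q)) ⟩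
      ∑ (λ r → - (ι * (α (suc r) * M r q)))       ≈⟨ ∑-cong (λ r → trans (-‿cong (sym (*-assoc ι (α (suc r)) (M r q)))) (-‿distribˡ-* (ι * α (suc r)) (M r q))) ⟩
      ∑ (λ r → - (ι * α (suc r)) * M r q)         ∎)
      where
      ι : Carrier
      ι = proj₁ (inverse (α zero) α₀≉0)
      α₀ι≈1 : α zero * ι ≈ 1#
      α₀ι≈1 = proj₂ (inverse (α zero) α₀≉0)

    -- (M B - I) M = M (B M) - M = 0, so the rows of M B - I lie in the trivial left kernel of M.
    leftInverse⇒rightInverse : LinIndep F (λ _ → ⊤) M → (B : Idx ks → Fin k → Carrier) →
                               (∀ q q′ → ∑ (λ r → B q r * M r q′) ≈ δᴵ q q′) →
                               ∀ r r′ → ∑ᴵ ks (λ q → M r q * B q r′) ≈ δᶠ r r′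
    leftInverse⇒rightInverse M-indep B BM≈I r r′ = x∙y⁻¹≈ε⇒x≈y _ _ (M-indep D (λ _ → tt) DM≈0 r′)
      where
      MBᵣ : Fin k → Carrier
      MBᵣ r′ = ∑ᴵ ks (λ q → M r q * B q r′)

      D : Fin k → Carrier
      D r′ = MBᵣ r′ - δᶠ r r′

      MBM≈M : ∀ q′ → ∑ (λ r′ → MBᵣ r′ * M r′ q′) ≈ M r q′
      MBM≈M q′ = begin
        ∑ (λ r′ → MBᵣ r′ * M r′ q′)                          ≈⟨ ∑-cong (λ r′ → *-distribʳ-∑ᴵ ks (M r′ q′) (λ q → M r q * B q r′)) ⟩
        ∑ (λ r′ → ∑ᴵ ks (λ q → (M r q * B q r′) * M r′ q′)) ≈⟨ ∑-∑ᴵ-comm ks (λ r′ q → (M r q * B q r′) * M r′ q′) ⟩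
        ∑ᴵ ks (λ q → ∑ (λ r′ → (M r q * B q r′) * M r′ q′)) ≈⟨ ∑ᴵ-cong ks (λ q → ∑-cong (λ r′ → *-assoc (M r q) (B q r′) (M r′ q′))) ⟩
        ∑ᴵ ks (λ q → ∑ (λ r′ → M r q * (B q r′ * M r′ q′))) ≈⟨ ∑ᴵ-cong ks (λ q → sym (*-distribˡ-∑ (M r q) (λ r′ → B q r′ * M r′ q′))) ⟩
        ∑ᴵ ks (λ q → M r q * ∑ (λ r′ → B q r′ * M r′ q′))   ≈⟨ ∑ᴵ-cong ks (λ q → *-congˡ (BM≈I q q′)) ⟩
        ∑ᴵ ks (λ q → M r q * δᴵ q q′)                       ≈⟨ ∑ᴵ-δʳ ks q′ (M r) ⟩
        M r q′                                              ∎

      DM≈0 : ∀ q′ → ∑ (λ r′ → D r′ * M r′ q′) ≈ 0#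
      DM≈0 q′ = begin
        ∑ (λ r′ → D r′ * M r′ q′)                         ≈⟨ ∑-cong (λ r′ → distribʳ (M r′ q′) (MBᵣ r′) (- δᶠ r r′)) ⟩
        ∑ (λ r′ → MBᵣ r′ * M r′ q′ + - δᶠ r r′ * M r′ q′)   ≈⟨ ∑-distrib-+ (λ r′ → MBᵣ r′ * M r′ q′) (λ r′ → - δᶠ r r′ * M r′ q′) ⟩
        _ + ∑ (λ r′ → - δᶠ r r′ * M r′ q′)                ≈⟨ +-cong (MBM≈M q′) (∑-cong (λ r′ → sym (-‿distribˡ-* (δᶠ r r′) (M r′ q′)))) ⟩
        M r q′ + ∑ (λ r′ → - (δᶠ r r′ * M r′ q′))         ≈⟨ +-congˡ (sym (-‿distrib-∑ (λ r′ → δᶠ r r′ * M r′ q′))) ⟩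
        M r q′ - ∑ (λ r′ → δᶠ r r′ * M r′ q′)             ≈⟨ +-congˡ (-‿cong (∑-δˡ r (λ r′ → M r′ q′))) ⟩
        M r q′ - M r q′                                  ≈⟨ -‿inverseʳ (M r q′) ⟩
        0#                                               ∎

    rows-indep⇒Invertible : sumℕ ks ≡ k → LinIndep F (λ _ → ⊤) M → Invertible F {k} {ks = ks} M
    rows-indep⇒Invertible Σks≡k M-indep = B , leftInverse⇒rightInverse M-indep B BM≈I , BM≈I
      where
      B : Idx ks → Fin k → Carrier
      B = proj₁ ∘ unitRow-combination Σks≡k M-indep

      BM≈I : ∀ q q′ → ∑ (λ r → B q r * M r q′) ≈ δᴵ q q′
      BM≈I = proj₂ ∘ unitRow-combination Σks≡k M-indep

module BlockDiagonal (F : FiniteField) {ℓ} {ns ks : Fin ℓ → ℕ}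
                     (A : (i : Fin ℓ) → Fin (ns i) → Fin (ks i) → FiniteField.Carrier F) where
  open FiniteField F using (commRing)
  open CommutativeRing commRing hiding (zero)
  open FiniteSums F

  blockDiag-diag : ∀ i t s → blockDiag F A (i , t) (i , s) ≡ A i t s
  blockDiag-diag i t s with i Fin.≟ i
  ... | yes ≡.refl = ≡.refl
  ... | no i≢i = ⊥-elim (i≢i ≡.refl)

  blockDiag-offdiag : ∀ {i′ i} t s → i′ ≢ i → blockDiag F A (i′ , t) (i , s) ≡ 0#
  blockDiag-offdiag {i′} {i} t s i′≢i with i′ Fin.≟ i
  ... | yes i′≡i = ⊥-elim (i′≢i i′≡i)
  ... | no _ = ≡.refl

  ∑ᴵ-blockDiagˡ : ∀ (g : Idx ns → Carrier) i s →
                  ∑ᴵ ns (λ p → g p * blockDiag F A p (i , s)) ≈ ∑ (λ t → g (i , t) * A i t s)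
  ∑ᴵ-blockDiagˡ g i s =
    trans (∑-single i _ (λ i′ i′≢i → ∑-zero (λ t → trans (*-congˡ (reflexive (blockDiag-offdiag t s i′≢i))) (zeroʳ _))))
          (∑-cong (λ t → *-congˡ (reflexive (blockDiag-diag i t s))))

  ∑ᴵ-blockDiagʳ : ∀ (a : Idx ks → Carrier) i t →
                  ∑ᴵ ks (λ q → blockDiag F A (i , t) q * a q) ≈ ∑ (λ s → A i t s * a (i , s))
  ∑ᴵ-blockDiagʳ a i t =
    trans (∑-single i _ (λ i′ i′≢i → ∑-zero (λ s → trans (*-congʳ (reflexive (blockDiag-offdiag t s (i′≢i ∘ ≡.sym)))) (zeroˡ _))))
          (∑-cong (λ s → *-congʳ (reflexive (blockDiag-diag i t s))))

  columns : ∀ i → Fin (ks i) → Fin (ns i) → Carrier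
  columns i s t = A i t s

  columns-indep⇒FullColumnRank : (∀ i → LinIndep F (λ _ → ⊤) (columns i)) → FullColumnRank F {ns = ns} {ks} (blockDiag F A)
  columns-indep⇒FullColumnRank columns-indep a Aa≈0 (i , s) = columns-indep i (λ s → a (i , s)) (λ _ → tt)
    (λ t → trans (∑-cong (λ s → *-comm (a (i , s)) (A i t s))) (trans (sym (∑ᴵ-blockDiagʳ a i t)) (Aa≈0 (i , t)))) s

  FullColumnRank⇒columns-indep : FullColumnRank F {ns = ns} {ks} (blockDiag F A) → ∀ i → LinIndep F (λ _ → ⊤) (columns i)
  FullColumnRank⇒columns-indep A-rank i b _ Σb·columns≈0 s =
    trans (reflexive (≡.sym (padded-self s))) (A-rank padded A·padded≈0 (i , s))
    where
    padded : Idx ks → Carrier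
    padded (i′ , s′) with i′ Fin.≟ i
    ... | yes ≡.refl = b s′
    ... | no _ = 0#

    padded-self : ∀ s → padded (i , s) ≡ b s
    padded-self s with i Fin.≟ i
    ... | yes ≡.refl = ≡.refl
    ... | no i≢i = ⊥-elim (i≢i ≡.refl)

    padded-other : ∀ {i′} s′ → i′ ≢ i → padded (i′ , s′) ≡ 0#
    padded-other {i′} s′ i′≢i with i′ Fin.≟ i
    ... | yes i′≡i = ⊥-elim (i′≢i i′≡i)
    ... | no _ = ≡.refl

    A·padded≈0 : ∀ p → ∑ᴵ ks (λ q → blockDiag F A p q * padded q) ≈ 0#
    A·padded≈0 (i′ , t) with i′ Fin.≟ i
    ... | yes ≡.refl = trans (∑ᴵ-blockDiagʳ padded i t)
        (trans (∑-cong (λ s → trans (*-congˡ (reflexive (padded-self s))) (*-comm (A i t s) (b s)))) (Σb·columns≈0 t))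
    ... | no i′≢i = trans (∑ᴵ-blockDiagʳ padded i′ t)
        (∑-zero (λ s → trans (*-congˡ (reflexive (padded-other s i′≢i))) (zeroʳ _)))

module Coordinates (F : FiniteField) (S : Subfield F) (B : OrderedBasis F S) where
  open FiniteField F using (commRing)
  open CommutativeRing commRing hiding (zero)
  open import Relation.Binary.Reasoning.Setoid setoid
  open FiniteSums F
  open SubfieldLinearAlgebra F S using (K-∑)
  open Subfield S
  open OrderedBasis B

  ·-Γrows : ∀ {n} (α y : Fin n → Carrier) → ∑ (λ j → (α · ΓMat F B y j) * γ j) ≈ α · y
  ·-Γrows α y = begin
    ∑ (λ j → (α · ΓMat F B y j) * γ j)                  ≈⟨ ∑-cong (λ j → *-comm (α · ΓMat F B y j) (γ j)) ⟩
    ∑ (λ j → γ j * (α · ΓMat F B y j))                  ≈⟨ ∑-·-linear γ α (ΓMat F B y) ⟩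
    α · (λ t → ∑ (λ j → γ j * coord (y t) j))           ≈⟨ ∑-cong (λ t → *-congˡ (sym (trans (expand (y t)) (∑-cong (λ j → *-comm (coord (y t) j) (γ j)))))) ⟩
    α · y                                               ∎

  ·≈0⇒·Γrows≈0 : ∀ {n} (α y : Fin n → Carrier) → (∀ t → K (α t)) → α · y ≈ 0# → ∀ j → α · ΓMat F B y j ≈ 0#
  ·≈0⇒·Γrows≈0 α y K-α α·y≈0 =
    indep (λ j → α · ΓMat F B y j) (λ j → K-∑ (λ t → K-* (K-α t) (coord-K (y t) j))) (trans (·-Γrows α y) α·y≈0)

  ·Γrows≈0⇒·≈0 : ∀ {n} (α y : Fin n → Carrier) → (∀ j → α · ΓMat F B y j ≈ 0#) → α · y ≈ 0#
  ·Γrows≈0⇒·≈0 α y α·rows≈0 = trans (sym (·-Γrows α y)) (∑-zero (λ j → trans (*-congʳ (α·rows≈0 j)) (zeroˡ (γ j))))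

  Γ-rowSpace-K : ∀ {n} (y v : Fin n → Carrier) → RowSpace F K (ΓMat F B y) v → ∀ t → K (v t)
  Γ-rowSpace-K y v (β , K-β , v≈Σβ·rows) t = K-resp (sym (v≈Σβ·rows t)) (K-∑ (λ j → K-* (K-β j) (coord-K (y t) j)))

  -- Split a relation over F into its coordinates in the basis γ.
  K-indep⇒indep : ∀ {d n} (v : Fin d → Fin n → Carrier) → (∀ r t → K (v r t)) → LinIndep F K v → LinIndep F (λ _ → ⊤) v
  K-indep⇒indep v K-v v-indep a _ Σa·v≈0 r = begin
    a r                            ≈⟨ expand (a r) ⟩
    ∑ (λ j → coord (a r) j * γ j)  ≈⟨ ∑-zero (λ j → trans (*-congʳ (v-indep (λ r → coord (a r) j) (λ r → coord-K (a r) j) (λ t → coordinate-relation t j) r)) (zeroˡ (γ j))) ⟩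
    0#                             ∎
    where
    coordinate-relation : ∀ t j → ΓMat F B a j · (λ r → v r t) ≈ 0#
    coordinate-relation t j = trans (·-comm (ΓMat F B a j) (λ r → v r t))
      (·≈0⇒·Γrows≈0 (λ r → v r t) a (λ r → K-v r t) (trans (·-comm (λ r → v r t) a) (Σa·v≈0 t)) j)

module MSRD (F : FiniteField) {ℓ} (ns : Fin ℓ → ℕ) (Ks : Fin ℓ → Subfield F)
            (Γ : (i : Fin ℓ) → OrderedBasis F (Ks i)) {k} (G : Fin k → Idx ns → FiniteField.Carrier F)
            (G-indep : LinIndep F (λ _ → ⊤) G) where
  open FiniteField F using (commRing; _≈?_)
  open CommutativeRing commRing hiding (zero)
  open import Relation.Binary.Reasoning.Setoid setoid
  open FiniteSums F
  open LinearAlgebra F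
  open SquareMatrices F
  open SumRank F ns Ks Γ
  open Subfield using (K)
  open SubfieldLinearAlgebra F using (complement)
  open Coordinates F using (·≈0⇒·Γrows≈0; ·Γrows≈0⇒·≈0; Γ-rowSpace-K)

  BlockProductsInvertible : Set
  BlockProductsInvertible =
    (ks : Fin ℓ → ℕ) → (∀ i → ks i ≤ ns i) → sumℕ ks ≡ k →
    (A : (i : Fin ℓ) → Fin (ns i) → Fin (ks i) → Carrier) → (∀ i t s → K (Ks i) (A i t s)) →
    FullColumnRank F {ns = ns} {ks} (blockDiag F A) → Invertible F {k} {ks = ks} (mulGM F G (blockDiag F A))

  codeword : (Fin k → Carrier) → Vec'
  codeword x p = ∑ (λ r → x r * G r p)

  codeword-scale : ∀ b x p → b * codeword x p ≈ codeword (λ r → b * x r) p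
  codeword-scale b x p =
    trans (*-distribˡ-∑ b (λ r → x r * G r p)) (∑-cong (λ r → sym (*-assoc b (x r) (G r p))))

  codeword-indep : ∀ x r → ¬ x r ≈ 0# → LinIndep F (λ _ → ⊤) {1} (λ _ → codeword x)
  codeword-indep x r xᵣ≉0 = singleton-indep (codeword x) λ b bc≈0 →
    nonzero-cancelˡ xᵣ≉0 (trans (*-comm (x r) b)
      (G-indep (λ r → b * x r) (λ _ → tt) (λ p → trans (sym (codeword-scale b x p)) (bc≈0 p)) r))

  block : Vec' → (i : Fin ℓ) → Fin (ns i) → Carrier
  block c i t = c (i , t)

  k≤N : k ≤ N
  k≤N = indep⇒≤sumℕ ns G G-indep

  codeword-mulGM : ∀ {ks : Fin ℓ → ℕ} (M : Idx ns → Idx ks → Carrier) x q →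
                   ∑ᴵ ns (λ p → codeword x p * M p q) ≈ ∑ (λ r → x r * mulGM F G M r q)
  codeword-mulGM M x q = begin
    ∑ᴵ ns (λ p → ∑ (λ r → x r * G r p) * M p q)   ≈⟨ ∑ᴵ-cong ns (λ p → *-distribʳ-∑ (M p q) (λ r → x r * G r p)) ⟩
    ∑ᴵ ns (λ p → ∑ (λ r → (x r * G r p) * M p q)) ≈⟨ sym (∑-∑ᴵ-comm ns (λ r p → (x r * G r p) * M p q)) ⟩
    ∑ (λ r → ∑ᴵ ns (λ p → (x r * G r p) * M p q)) ≈⟨ ∑-cong (λ r → ∑ᴵ-cong ns (λ p → *-assoc (x r) (G r p) (M p q))) ⟩
    ∑ (λ r → ∑ᴵ ns (λ p → x r * (G r p * M p q))) ≈⟨ ∑-cong (λ r → sym (*-distribˡ-∑ᴵ ns (x r) (λ p → G r p * M p q))) ⟩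
    ∑ (λ r → x r * mulGM F G M r q)               ∎

  module _ {ds : Fin ℓ → ℕ} (W : (i : Fin ℓ) → Fin (ds i) → Fin (ns i) → Carrier)
           (W-K : ∀ i s t → K (Ks i) (W i s t)) where

    complementᵢ : ∀ i → SubfieldLinearAlgebra.Complement F (Ks i) (W i)
    complementᵢ i = complement (Ks i) (W i) (W-K i)

    complements : SubTuple
    complements i = SubfieldLinearAlgebra.Complement.space (complementᵢ i)

    N≤Rk+Σds : N ≤ Rk complements ℕ.+ sumℕ ds
    N≤Rk+Σds = ℕ.≤-trans (sumℕ-mono-≤ (SubfieldLinearAlgebra.Complement.dim-lower ∘ complementᵢ))
                         (ℕ.≤-reflexive (sumℕ-distrib-+ (Subspace.dim ∘ complements) ds))

    Rk+Σds≤N : (∀ i → LinIndep F (K (Ks i)) (W i)) → Rk complements ℕ.+ sumℕ ds ≤ N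
    Rk+Σds≤N W-indep = ℕ.≤-trans (ℕ.≤-reflexive (≡.sym (sumℕ-distrib-+ (Subspace.dim ∘ complements) ds)))
                                 (sumℕ-mono-≤ (λ i → SubfieldLinearAlgebra.Complement.dim-upper (complementᵢ i) (W-indep i)))

    ⊥W⇒SuppIn-complements : ∀ c → (∀ i s → W i s · block c i ≈ 0#) → SuppIn c complements
    ⊥W⇒SuppIn-complements c W⊥c i v v∈rowsΓ = spanning v (Γ-rowSpace-K (Ks i) (Γ i) (block c i) v v∈rowsΓ) W⊥v
      where
      open SubfieldLinearAlgebra.Complement (complementᵢ i)
      W⊥v : ∀ s → W i s · v ≈ 0#
      W⊥v s = rowSpace-⊥ (K (Ks i)) (ΓMat F (Γ i) (block c i)) v∈rowsΓ
                (·≈0⇒·Γrows≈0 (Ks i) (Γ i) (W i s) (block c i) (W-K i s) (W⊥c i s))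

  SuppIn⇒⊥ : ∀ c L → SuppIn c L → ∀ i (α : Fin (ns i) → Carrier) →
             (∀ r → Subspace.basis (L i) r · α ≈ 0#) → α · block c i ≈ 0#
  SuppIn⇒⊥ c L c∈V i α L⊥α = ·Γrows≈0⇒·≈0 (Ks i) (Γ i) α (block c i) λ j →
    rowSpace-⊥ (K (Ks i)) (Subspace.basis (L i))
      (c∈V i (ΓMat F (Γ i) (block c i) j) Γrow∈rowsΓ)
      (λ r → trans (·-comm α (Subspace.basis (L i) r)) (L⊥α r))
    where
    Γrow∈rowsΓ : ∀ {j} → RowSpace F (K (Ks i)) (ΓMat F (Γ i) (block c i)) (ΓMat F (Γ i) (block c i) j)
    Γrow∈rowsΓ {j} = δᶠ j , SubfieldLinearAlgebra.K-δ F (Ks i) Fin._≟_ j , λ t → sym (∑-δˡ j (λ j′ → ΓMat F (Γ i) (block c i) j′ t))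

  MSRD⇒BlockProductsInvertible : IsMSRD G → BlockProductsInvertible
  MSRD⇒BlockProductsInvertible (_ , weight-minimal) ks ks≤ns Σks≡k A A-K A-rank =
    rows-indep⇒Invertible ks M Σks≡k M-rows-indep
    where
    open BlockDiagonal F A using (columns; ∑ᴵ-blockDiagˡ; FullColumnRank⇒columns-indep)
    M : Fin k → Idx ks → Carrier
    M = mulGM F G (blockDiag F A)

    columns-K : ∀ i s t → K (Ks i) (columns i s t)
    columns-K i s t = A-K i t s

    L : SubTuple
    L = complements columns columns-K

    Rk+k≤N : Rk L ℕ.+ k ≤ N
    Rk+k≤N = ≡.subst (λ k′ → Rk L ℕ.+ k′ ≤ N) Σks≡k
      (Rk+Σds≤N columns columns-K (λ i b _ → FullColumnRank⇒columns-indep A-rank i b (λ _ → tt)))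

    M-rows-indep : LinIndep F (λ _ → ⊤) M
    M-rows-indep x _ xM≈0 r with x r ≈? 0#
    ... | yes xᵣ≈0 = xᵣ≈0
    ... | no xᵣ≉0 = ⊥-elim (m+n≤o⇒o∸n+1≰m Rk+k≤N (weight-minimal L c∈C∩V))
      where
      c : Vec'
      c = codeword x

      columns⊥c : ∀ i s → columns i s · block c i ≈ 0#
      columns⊥c i s = begin
        ∑ (λ t → A i t s * c (i , t))                  ≈⟨ ∑-cong (λ t → *-comm (A i t s) (c (i , t))) ⟩
        ∑ (λ t → c (i , t) * A i t s)                  ≈⟨ sym (∑ᴵ-blockDiagˡ c i s) ⟩
        ∑ᴵ ns (λ p → c p * blockDiag F A p (i , s))    ≈⟨ codeword-mulGM (blockDiag F A) x (i , s) ⟩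
        ∑ (λ r → x r * M r (i , s))                    ≈⟨ xM≈0 (i , s) ⟩
        0#                                             ∎

      c∈C∩V : DimAtLeast G 1 L
      c∈C∩V = (λ _ → c) , (λ _ → (x , λ _ → refl) , ⊥W⇒SuppIn-complements columns columns-K c columns⊥c) , codeword-indep x r xᵣ≉0

  -- For a codeword c = x G with supp(c) ⊆ L and Rk L ≤ n - k, the orthogonal complements of the Lᵢ
  -- have total dimension ≥ k; k of their basis vectors form the columns of an A with x (G A) = c A = 0.
  module LightCodeword (invertible : BlockProductsInvertible) (L : SubTuple) (c : Vec') (c∈C : InCode G c)
                       (c∈V : SuppIn c L) (light : ¬ (N ℕ.∸ k ℕ.+ 1 ≤ Rk L)) where

    x : Fin k → Carrier
    x = proj₁ c∈C

    c≈xG : ∀ p → c p ≈ codeword x p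
    c≈xG = proj₂ c∈C

    module Lᶜ i = SubfieldLinearAlgebra.Complement (complementᵢ (Subspace.basis ∘ L) (Subspace.basis-K ∘ L) i)

    k≤ΣdimLᶜ : k ≤ sumℕ Lᶜ.dim
    k≤ΣdimLᶜ = o≤m+n⇒k≤m k≤N (N≤Rk+Σds (Subspace.basis ∘ L) (Subspace.basis-K ∘ L)) light

    ks : Fin ℓ → ℕ
    ks = proj₁ (≤sumℕ⇒decomposition Lᶜ.dim k k≤ΣdimLᶜ)

    ks≤dim : ∀ i → ks i ≤ Lᶜ.dim i
    ks≤dim = proj₁ (proj₂ (≤sumℕ⇒decomposition Lᶜ.dim k k≤ΣdimLᶜ))

    Σks≡k : sumℕ ks ≡ k
    Σks≡k = proj₂ (proj₂ (≤sumℕ⇒decomposition Lᶜ.dim k k≤ΣdimLᶜ))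

    ks≤ns : ∀ i → ks i ≤ ns i
    ks≤ns i = ℕ.≤-trans (ks≤dim i) (ℕ.≤-trans (ℕ.m≤m+n _ _) (Lᶜ.dim-upper i (Subspace.basis-indep (L i))))

    σ : ∀ i → Fin (ks i) → Fin (Lᶜ.dim i)
    σ i s = Fin.inject≤ s (ks≤dim i)

    A : (i : Fin ℓ) → Fin (ns i) → Fin (ks i) → Carrier
    A i t s = Lᶜ.basis i (σ i s) t

    A-K : ∀ i t s → K (Ks i) (A i t s)
    A-K i t s = Lᶜ.basis-K i (σ i s) t

    open BlockDiagonal F A using (columns; ∑ᴵ-blockDiagˡ; columns-indep⇒FullColumnRank)

    A-rank : FullColumnRank F {ns = ns} {ks} (blockDiag F A)
    A-rank = columns-indep⇒FullColumnRank λ i →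
      Coordinates.K-indep⇒indep F (Ks i) (Γ i) (columns i) (λ s t → A-K i t s)
        (SubfieldLinearAlgebra.LinIndep-reindex F (Ks i) (Lᶜ.basis i) (σ i) (Fin.inject≤-injective _ _ _ _) (Lᶜ.basis-indep i))

    M : Fin k → Idx ks → Carrier
    M = mulGM F G (blockDiag F A)

    xM≈0 : ∀ q → ∑ (λ r → x r * M r q) ≈ 0#
    xM≈0 (i , s) = begin
      ∑ (λ r → x r * M r (i , s))                            ≈⟨ sym (codeword-mulGM (blockDiag F A) x (i , s)) ⟩
      ∑ᴵ ns (λ p → codeword x p * blockDiag F A p (i , s))   ≈⟨ ∑ᴵ-cong ns (λ p → *-congʳ (sym (c≈xG p))) ⟩
      ∑ᴵ ns (λ p → c p * blockDiag F A p (i , s))            ≈⟨ ∑ᴵ-blockDiagˡ c i s ⟩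
      block c i · columns i s                                ≈⟨ ·-comm (block c i) (columns i s) ⟩
      columns i s · block c i                                ≈⟨ SuppIn⇒⊥ c L c∈V i (columns i s) (λ r → Lᶜ.orthogonal i r (σ i s)) ⟩
      0#                                                     ∎

    x≈0 : ∀ r → x r ≈ 0#
    x≈0 = Invertible⇒rows-indep ks M (invertible ks ks≤ns Σks≡k A A-K A-rank) x (λ _ → tt) xM≈0

    vanishes : ∀ p → c p ≈ 0#
    vanishes p = trans (c≈xG p) (∑-zero (λ r → trans (*-congʳ (x≈0 r)) (zeroˡ (G r p))))

  BlockProductsInvertible⇒weight≥ : BlockProductsInvertible → ∀ L → DimAtLeast G 1 L → N ℕ.∸ k ℕ.+ 1 ≤ Rk L
  BlockProductsInvertible⇒weight≥ invertible L (w , w∈C∩V , w-indep) with N ℕ.∸ k ℕ.+ 1 ℕ.≤? Rk L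
  ... | yes bound = bound
  ... | no light = ⊥-elim (zeroRow-¬indep (λ _ → ⊤) w zero (λ _ → tt) w₀≈0 w-indep)
    where
    w₀≈0 : ∀ p → w zero p ≈ 0#
    w₀≈0 = LightCodeword.vanishes invertible L (w zero) (proj₁ (w∈C∩V zero)) (proj₂ (w∈C∩V zero)) light


  -- Split k = (k - 1) + 1 into kk ≤ n with one extra unit in a block i₀ where kk i₀ < n i₀, and let A
  -- select the first ksᵢ coordinates of each block. The row of (G A)⁻¹ indexed by the extra column q₀
  -- gives a codeword vanishing on the first kkᵢ coordinates of each block but not on q₀.
  module WeightAttained (invertible : BlockProductsInvertible) (1≤k : 1 ≤ k) where

    1+[k∸1]≡k : suc (k ℕ.∸ 1) ≡ k
    1+[k∸1]≡k = ℕ.m+[n∸m]≡n 1≤k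

    k∸1≤N : k ℕ.∸ 1 ≤ N
    k∸1≤N = ℕ.≤-trans (ℕ.m∸n≤m k 1) k≤N

    kk : Fin ℓ → ℕ
    kk = proj₁ (≤sumℕ⇒decomposition ns (k ℕ.∸ 1) k∸1≤N)

    kk≤ns : ∀ i → kk i ≤ ns i
    kk≤ns = proj₁ (proj₂ (≤sumℕ⇒decomposition ns (k ℕ.∸ 1) k∸1≤N))

    Σkk≡k∸1 : sumℕ kk ≡ k ℕ.∸ 1
    Σkk≡k∸1 = proj₂ (proj₂ (≤sumℕ⇒decomposition ns (k ℕ.∸ 1) k∸1≤N))

    Σkk<N : sumℕ kk < N
    Σkk<N = ℕ.≤-trans (ℕ.≤-reflexive (≡.trans (≡.cong suc Σkk≡k∸1) 1+[k∸1]≡k)) k≤N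

    i₀ : Fin ℓ
    i₀ = proj₁ (sumℕ<⇒∃< kk ns Σkk<N)

    kk<ns-i₀ : kk i₀ < ns i₀
    kk<ns-i₀ = proj₂ (sumℕ<⇒∃< kk ns Σkk<N)

    ks : Fin ℓ → ℕ
    ks = updateAt kk i₀ suc

    ks-i₀ : ks i₀ ≡ suc (kk i₀)
    ks-i₀ = Vector.updateAt-updates i₀ kk

    kk≤ks : ∀ i → kk i ≤ ks i
    kk≤ks i with i Fin.≟ i₀
    ... | yes ≡.refl = ℕ.≤-trans (ℕ.n≤1+n (kk i)) (ℕ.≤-reflexive (≡.sym ks-i₀))
    ... | no i≢i₀ = ℕ.≤-reflexive (≡.sym (Vector.updateAt-minimal i i₀ kk i≢i₀))

    ks≤ns : ∀ i → ks i ≤ ns i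
    ks≤ns i with i Fin.≟ i₀
    ... | yes ≡.refl = ℕ.≤-trans (ℕ.≤-reflexive ks-i₀) kk<ns-i₀
    ... | no i≢i₀ = ℕ.≤-trans (ℕ.≤-reflexive (Vector.updateAt-minimal i i₀ kk i≢i₀)) (kk≤ns i)

    Σks≡k : sumℕ ks ≡ k
    Σks≡k = ≡.trans (sumℕ-updateAt-suc kk i₀) (≡.trans (≡.cong suc Σkk≡k∸1) 1+[k∸1]≡k)

    σ : ∀ i → Fin (ks i) → Fin (ns i)
    σ i s = Fin.inject≤ s (ks≤ns i)

    A : (i : Fin ℓ) → Fin (ns i) → Fin (ks i) → Carrier
    A i t s = δᶠ (σ i s) t

    open BlockDiagonal F A using (∑ᴵ-blockDiagˡ; columns-indep⇒FullColumnRank)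

    M : Fin k → Idx ks → Carrier
    M = mulGM F G (blockDiag F A)

    M-inverse : Invertible F {k} {ks = ks} M
    M-inverse = invertible ks ks≤ns Σks≡k A (λ i t s → SubfieldLinearAlgebra.K-δ F (Ks i) Fin._≟_ (σ i s) t)
      (columns-indep⇒FullColumnRank (λ i → unitVectors-indep (λ _ → ⊤) (σ i) (Fin.inject≤-injective _ _ _ _)))

    q₀ : Idx ks
    q₀ = i₀ , Fin.fromℕ< (≡.subst (kk i₀ <_) (≡.sym ks-i₀) (ℕ.n<1+n (kk i₀)))

    x : Fin k → Carrier
    x = proj₁ M-inverse q₀

    c : Vec'
    c = codeword x

    c-at-σ : ∀ i s → c (i , σ i s) ≈ δᴵ q₀ (i , s)
    c-at-σ i s = begin
      ∑ (λ r → x r * G r (i , σ i s))   ≈⟨ ∑-cong (λ r → *-congˡ (sym (M-column r))) ⟩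
      ∑ (λ r → x r * M r (i , s))       ≈⟨ proj₂ (proj₂ M-inverse) q₀ (i , s) ⟩
      δᴵ q₀ (i , s)                     ∎
      where
      M-column : ∀ r → M r (i , s) ≈ G r (i , σ i s)
      M-column r = trans (∑ᴵ-blockDiagˡ (G r) i s)
        (trans (∑-cong (λ t → *-congˡ (reflexive (δ-comm Fin._≟_ (σ i s) t)))) (∑-δʳ (σ i s) (λ t → G r (i , t))))

    below-kk≢q₀ : ∀ i (s : Fin (ks i)) → Fin.toℕ s < kk i → (i , s) ≢ q₀
    below-kk≢q₀ _ _ s<kk ≡.refl = ℕ.<-irrefl (Fin.toℕ-fromℕ< _) s<kk

    τ : ∀ i → Fin (kk i) → Fin (ns i)
    τ i u = Fin.inject≤ u (kk≤ns i)

    W : (i : Fin ℓ) → Fin (kk i) → Fin (ns i) → Carrier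
    W i u = δᶠ (τ i u)

    W-K : ∀ i u t → K (Ks i) (W i u t)
    W-K i u = SubfieldLinearAlgebra.K-δ F (Ks i) Fin._≟_ (τ i u)

    W⊥c : ∀ i u → W i u · block c i ≈ 0#
    W⊥c i u = begin
      W i u · block c i                     ≈⟨ ∑-δˡ (τ i u) (block c i) ⟩
      c (i , τ i u)                         ≈⟨ reflexive (≡.cong (λ t → c (i , t)) τ≡σ) ⟩
      c (i , σ i (Fin.inject≤ u (kk≤ks i))) ≈⟨ c-at-σ i _ ⟩
      δᴵ q₀ (i , Fin.inject≤ u (kk≤ks i))   ≈⟨ reflexive (δ-offdiag (≡-dec Fin._≟_ Fin._≟_) (below-kk≢q₀ i _ u<kk ∘ ≡.sym)) ⟩
      0#                                    ∎
      where
      τ≡σ : τ i u ≡ σ i (Fin.inject≤ u (kk≤ks i))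
      τ≡σ = Fin.toℕ-injective (≡.trans (Fin.toℕ-inject≤ u _)
              (≡.sym (≡.trans (Fin.toℕ-inject≤ _ _) (Fin.toℕ-inject≤ u _))))
      u<kk : Fin.toℕ (Fin.inject≤ u (kk≤ks i)) < kk i
      u<kk = ≡.subst (_< kk i) (≡.sym (Fin.toℕ-inject≤ u _)) (Fin.toℕ<n u)

    L : SubTuple
    L = complements W W-K

    Rk-L : Rk L ≡ N ℕ.∸ k ℕ.+ 1
    Rk-L = m+[k∸1]≡o⇒m≡o∸k+1 1≤k k≤N (≡.subst (λ m → Rk L ℕ.+ m ≡ N) Σkk≡k∸1
      (ℕ.≤-antisym (Rk+Σds≤N W W-K (λ i → unitVectors-indep (K (Ks i)) (τ i) (Fin.inject≤-injective _ _ _ _)))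
                   (N≤Rk+Σds W W-K)))

    c-indep : LinIndep F (λ _ → ⊤) {1} (λ _ → c)
    c-indep = singleton-indep c λ b bc≈0 → begin
      b                          ≈⟨ sym (*-identityʳ b) ⟩
      b * 1#                     ≈⟨ *-congˡ (sym (trans (c-at-σ i₀ s₀) (reflexive (δ-diag (≡-dec Fin._≟_ Fin._≟_) q₀)))) ⟩
      b * c (i₀ , σ i₀ s₀)       ≈⟨ bc≈0 (i₀ , σ i₀ s₀) ⟩
      0#                         ∎
      where s₀ = proj₂ q₀

    weight-attained : Σ SubTuple λ L → (Rk L ≡ N ℕ.∸ k ℕ.+ 1 × DimAtLeast G 1 L)
    weight-attained = L , Rk-L , (λ _ → c) , (λ _ → (x , λ _ → refl) , ⊥W⇒SuppIn-complements W W-K c W⊥c) , c-indep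

  BlockProductsInvertible⇒MSRD : BlockProductsInvertible → 1 ≤ k → IsMSRD G
  BlockProductsInvertible⇒MSRD invertible 1≤k =
    WeightAttained.weight-attained invertible 1≤k , BlockProductsInvertible⇒weight≥ invertible

theorem24 :
    (F : FiniteField) (ℓ : ℕ) (ns : Fin ℓ → ℕ) (Ks : Fin ℓ → Subfield F)
    (Γ : (i : Fin ℓ) → OrderedBasis F (Ks i)) →
    1 ≤ ℓ → (∀ i → 1 ≤ ns i) →
    (k : ℕ) → 1 ≤ k →
    (G : Fin k → Idx ns → FiniteField.Carrier F) →
    LinIndep F (λ _ → ⊤) G →
    SumRank.IsMSRD F ns Ks Γ G ⇔
      ((ks : Fin ℓ → ℕ) → (∀ i → ks i ≤ ns i) → sumℕ ks ≡ k →
       (A : (i : Fin ℓ) → Fin (ns i) → Fin (ks i) → FiniteField.Carrier F) →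
       (∀ i t s → Subfield.K (Ks i) (A i t s)) →
       FullColumnRank F {ns = ns} {ks} (blockDiag F A) →
       Invertible F {k} {ks = ks} (mulGM F G (blockDiag F A)))
theorem24 F ℓ ns Ks Γ _ _ k 1≤k G G-indep =
  mk⇔ MSRD⇒BlockProductsInvertible (λ invertible → BlockProductsInvertible⇒MSRD invertible 1≤k)
  where open MSRD F ns Ks Γ G G-indep
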